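{- Fix $n\in\mathbb{N}$, let $e(n)=2^{2^n}$ and let $\mathcal P$ be as in the context. For any $j\in[1,4]$ and any monomial $\alpha$ with $c_{jn}s_n+\alpha\in\langle\mathcal P\rangle$, if $f_n$ divides $\alpha$ then $\alpha=b_{jn}^{e(n)}c_{jn}f_n$.
   Context: $\mathbb{Z}_2$ is the field with two elements; $\langle\mathcal P\rangle$ is the ideal generated by $\mathcal P$ in the polynomial ring over $\mathbb{Z}_2$ in distinct variables $s_i,f_i,q_{ki},c_{ki},b_{ki}$ ($i\in\{0,\dots,n\}$, $k\in\{1,2,3,4\}$) (possibly together with further variables). $\mathcal P=\bigcup_{m=0}^{n}\mathcal P_m$, where $\mathcal P_0=\{b_{i0}^2c_{i0}f_0+c_{i0}s_0 : i\in\{1,2,3,4\}\}$ and, for $1\le m\le n$, $\mathcal P_m$ consists of $q_{1m}c_{1(m-1)}s_{m-1}+s_m$; $q_{2m}c_{2(m-1)}s_{m-1}+q_{1m}b_{1(m-1)}c_{1(m-1)}f_{m-1}$; $q_{3m}c_{3(m-1)}f_{m-1}+q_{2m}c_{2(m-1)}f_{m-1}$; $q_{3m}b_{1(m-1)}c_{3(m-1)}s_{m-1}+q_{2m}b_{4(m-1)}c_{2(m-1)}s_{m-1}$; $q_{4m}b_{4(m-1)}c_{4(m-1)}f_{m-1}+q_{3m}c_{3(m-1)}s_{m-1}$; $q_{4m}c_{4(m-1)}s_{m-1}+f_m$; and $q_{2m}b_{3(m-1)}b_{im}c_{im}f_{m-1}+q_{2m}b_{2(m-1)}c_{im}f_{m-1}$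 for $i\in\{1,2,3,4\}$. -}

module Defs where

open import Data.Nat using (ℕ; zero; suc; _^_)
import Data.Nat as ℕ
open import Data.Bool using (Bool; true; false; not; if_then_else_)
open import Data.List using (List; []; _∷_; _++_; map; concatMap; replicate; foldr)
open import Data.List.Properties using (≡-dec)
open import Data.List.Membership.Propositional using (_∈_)
open import Data.List.Relation.Unary.All as All using (All)
open import Data.Maybe using (Maybe; just; nothing)
open import Data.Product using (Σ; _×_; _,_; proj₁; proj₂; ∃)
open import Relation.Nullary using (Dec; yes; no; ¬_)
open import Relation.Nullary.Decidable using (⌊_⌋)
open import Relation.Binary.PropositionalEquality using (_≡_; refl; cong)
open import Relation.Binary.Definitions using (DecidableEquality)

-- Variables of the polynomial ring.
-- s i, f i, q k i (= q_{ki}), c k i (= c_{ki}), b k i (= b_{ki});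
-- x i are the "further variables" (countably many extra variables).
-- (q/c/b with k ∉ {1,2,3,4} are simply further variables as well.)

data Var : Set where
  s f x : ℕ → Var
  q c b : ℕ → ℕ → Var

private
  encode : Var → List ℕ
  encode (s i)   = 0 ∷ i ∷ []
  encode (f i)   = 1 ∷ i ∷ []
  encode (x i)   = 2 ∷ i ∷ []
  encode (q k i) = 3 ∷ k ∷ i ∷ []
  encode (c k i) = 4 ∷ k ∷ i ∷ []
  encode (b k i) = 5 ∷ k ∷ i ∷ []

  decode : List ℕ → Maybe Var
  decode (0 ∷ i ∷ [])     = just (s i)
  decode (1 ∷ i ∷ [])     = just (f i)
  decode (2 ∷ i ∷ [])     = just (x i)
  decode (3 ∷ k ∷ i ∷ []) = just (q k i)
  decode (4 ∷ k ∷ i ∷ []) = just (c k i)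
  decode (5 ∷ k ∷ i ∷ []) = just (b k i)
  decode _                = nothing

  dec-enc : ∀ v → decode (encode v) ≡ just v
  dec-enc (s i)   = refl
  dec-enc (f i)   = refl
  dec-enc (x i)   = refl
  dec-enc (q k i) = refl
  dec-enc (c k i) = refl
  dec-enc (b k i) = refl

  just-inj : {v w : Var} → just v ≡ just w → v ≡ w
  just-inj refl = refl

_≟V_ : DecidableEquality Var
v ≟V w with ≡-dec ℕ._≟_ (encode v) (encode w)
... | yes e = yes (just-inj (Relation.Binary.PropositionalEquality.trans
                   (Relation.Binary.PropositionalEquality.sym (dec-enc v))
                   (Relation.Binary.PropositionalEquality.trans (cong decode e) (dec-enc w))))
... | no ne = no (λ e → ne (cong encode e))

-- Monomials: formal products of variables (a list, order irrelevant).
-- Polynomials over ℤ₂: formal sums of monomials (a list; the coefficient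
-- of a monomial is the parity of its number of occurrences).

Mono : Set
Mono = List Var

Poly : Set
Poly = List Mono

expo : Var → Mono → ℕ
expo v []      = 0
expo v (w ∷ m) = if ⌊ v ≟V w ⌋ then suc (expo v m) else expo v m

_≈M_ : Mono → Mono → Set
m₁ ≈M m₂ = ∀ v → expo v m₁ ≡ expo v m₂

-- decision procedure (only variables occurring in m₁ or m₂ matter)
_≈M?_ : Mono → Mono → Bool
m₁ ≈M? m₂ = ⌊ All.all? (λ v → expo v m₁ ℕ.≟ expo v m₂) (m₁ ++ m₂) ⌋

coeff : Poly → Mono → Bool
coeff p μ = foldr (λ m acc → if m ≈M? μ then not acc else acc) false p

_≈P_ : Poly → Poly → Set
p ≈P r = ∀ μ → coeff p μ ≡ coeff r μ

_+P_ : Poly → Poly → Poly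
p +P r = p ++ r

_*P_ : Poly → Poly → Poly
p *P r = concatMap (λ m → map (m ++_) r) p

mono : Mono → Poly
mono m = m ∷ []

_∣P_ : Poly → Poly → Set
p ∣P r = ∃ λ t → r ≈P (p *P t)

lincomb : List (Poly × Poly) → Poly
lincomb = foldr (λ rg acc → (proj₁ rg *P proj₂ rg) +P acc) []

_∈⟨_⟩ : Poly → List Poly → Set
h ∈⟨ G ⟩ = Σ (List (Poly × Poly)) λ rs → All (λ rg → proj₂ rg ∈ G) rs × h ≈P lincomb rs

𝒫₀ : List Poly
𝒫₀ = map (λ i → (b i 0 ∷ b i 0 ∷ c i 0 ∷ f 0 ∷ []) ∷ (c i 0 ∷ s 0 ∷ []) ∷ [])
         (1 ∷ 2 ∷ 3 ∷ 4 ∷ [])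

-- 𝒫_m for m = suc p (so m-1 = p)
𝒫suc : ℕ → List Poly
𝒫suc p =
  let m = suc p in
  ((q 1 m ∷ c 1 p ∷ s p ∷ []) ∷ (s m ∷ []) ∷ []) ∷
  ((q 2 m ∷ c 2 p ∷ s p ∷ []) ∷ (q 1 m ∷ b 1 p ∷ c 1 p ∷ f p ∷ []) ∷ []) ∷
  ((q 3 m ∷ c 3 p ∷ f p ∷ []) ∷ (q 2 m ∷ c 2 p ∷ f p ∷ []) ∷ []) ∷
  ((q 3 m ∷ b 1 p ∷ c 3 p ∷ s p ∷ []) ∷ (q 2 m ∷ b 4 p ∷ c 2 p ∷ s p ∷ []) ∷ []) ∷
  ((q 4 m ∷ b 4 p ∷ c 4 p ∷ f p ∷ []) ∷ (q 3 m ∷ c 3 p ∷ s p ∷ []) ∷ []) ∷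
  ((q 4 m ∷ c 4 p ∷ s p ∷ []) ∷ (f m ∷ []) ∷ []) ∷
  map (λ i → (q 2 m ∷ b 3 p ∷ b i m ∷ c i m ∷ f p ∷ []) ∷ (q 2 m ∷ b 2 p ∷ c i m ∷ f p ∷ []) ∷ [])
      (1 ∷ 2 ∷ 3 ∷ 4 ∷ [])

𝒫 : ℕ → List Poly
𝒫 zero    = 𝒫₀
𝒫 (suc p) = 𝒫suc p ++ 𝒫 p

e : ℕ → ℕ
e n = 2 ^ (2 ^ n)

-- Over ℤ₂ a binomial μ + ν can only lie in an ideal generated by binomials x + y if every
-- class of monomials that is closed under the moves u·x ↔ u·y contains both or neither of
-- μ and ν: the parity of the number of monomials of a polynomial lying in such a class is a
-- linear functional that kills every u·(x + y), hence the whole ideal.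
--
-- The class used here is read off the nested counter machine of the paper.  A level-m
-- configuration is s_m (progress 0), f_m (progress e m), or q_{r,m} c_{r,m-1} times powers of
-- the b_{k,m-1} times a level-(m-1) configuration; the exponents of the b's together with the
-- progress of level m-1 determine the progress of level m, which runs from 0 to
-- e (m-1) · e (m-1) = e m.  Every move keeps this shape and balances the progress of level m
-- against the b_{k,m} it consumes or produces, so the monomials c_{jn} b_{jn}^P · (level-n
-- configuration of progress P) form a closed class containing c_{jn} s_n.  If such a monomial
-- is divisible by f_n, the level-n configuration is f_n itself, its progress is e n, and the
-- monomial is b_{jn}^{e n} c_{jn} f_n.

module Submission where

open import Defs
open import Data.Nat using (ℕ; _≤_)
open import Data.List using (List; _∷_; []; _++_; replicate)

open import Data.Bool using (Bool; true; false; not; _∧_; _xor_; if_then_else_)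
open import Data.Bool.Properties using (T-≡; xor-assoc; xor-comm; xor-same; xor-identityʳ)
open import Data.Empty using (⊥; ⊥-elim)
open import Data.List using (map; foldr; length)
open import Data.List.Properties using (length-++)
open import Data.List.Membership.Propositional using (_∈_)
open import Data.List.Membership.Propositional.Properties using (∈-∃++; ∈-map⁻; ∈-++⁻)
open import Data.List.Relation.Unary.All as All using (All; []; _∷_)
open import Data.List.Relation.Unary.All.Properties using (++⁺; map⁺)
open import Data.List.Relation.Unary.AllPairs using (AllPairs; []; _∷_)
open import Data.List.Relation.Unary.Any using (here; there)
open import Data.Nat using (zero; suc; _+_; _*_; _^_; _∸_; _≤ᵇ_; _≡ᵇ_; _≤?_; _≟_; z≤n; s≤s)
open import Data.Nat.ListAction using (sum)
open import Data.Nat.Properties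
open import Algebra.Properties.CommutativeSemigroup +-commutativeSemigroup using (interchange)
open import Data.Nat.Tactic.RingSolver using (solve-∀)
open import Data.Product using (∃; ∃₂; _×_; _,_; proj₁; proj₂)
open import Data.Sum using (_⊎_; inj₁; inj₂)
open import Function using (id; _∘_; Equivalence; mk⇔)
open import Relation.Nullary using (¬_; Dec; yes; no; does; ¬?; _×-dec_; _⊎-dec_; _→-dec_)
open import Relation.Nullary.Decidable using (⌊_⌋; isYes≗does; dec-true; dec-false; does-⇔; map′; True; toWitness)
open import Relation.Binary.PropositionalEquality

private
  true≢false : true ≢ false
  true≢false ()

-- c_{k,i} and b_{k,i} live at level i+1: they are the registers of the level-(i+1) machine.
level : Var → ℕ
level (s i)   = i
level (f i)   = i
level (x i)   = i
level (q _ i) = i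
level (c _ i) = suc i
level (b _ i) = suc i

-- 𝒫suc p is, definitionally, 𝒫suc 0 shifted by p; all side conditions on the generators of
-- a level are therefore decided by evaluation on the closed level-1 generators.
shift : ℕ → Var → Var
shift p (s i)   = s (i + p)
shift p (f i)   = f (i + p)
shift p (x i)   = x (i + p)
shift p (q k i) = q k (i + p)
shift p (c k i) = c k (i + p)
shift p (b k i) = b k (i + p)

level-shift : ∀ p v → level (shift p v) ≡ level v + p
level-shift p (s i)   = refl
level-shift p (f i)   = refl
level-shift p (x i)   = refl
level-shift p (q k i) = refl
level-shift p (c k i) = refl
level-shift p (b k i) = refl

private
  unshift : ℕ → Var → Var
  unshift p (s i)   = s (i ∸ p)
  unshift p (f i)   = f (i ∸ p)
  unshift p (x i)   = x (i ∸ p)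
  unshift p (q k i) = q k (i ∸ p)
  unshift p (c k i) = c k (i ∸ p)
  unshift p (b k i) = b k (i ∸ p)

  unshift-shift : ∀ p v → unshift p (shift p v) ≡ v
  unshift-shift p (s i)   = cong s (m+n∸n≡m i p)
  unshift-shift p (f i)   = cong f (m+n∸n≡m i p)
  unshift-shift p (x i)   = cong x (m+n∸n≡m i p)
  unshift-shift p (q k i) = cong (q k) (m+n∸n≡m i p)
  unshift-shift p (c k i) = cong (c k) (m+n∸n≡m i p)
  unshift-shift p (b k i) = cong (b k) (m+n∸n≡m i p)

shift-injective : ∀ p {v w} → shift p v ≡ shift p w → v ≡ w
shift-injective p {v} {w} eq =
  trans (sym (unshift-shift p v)) (trans (cong (unshift p) eq) (unshift-shift p w))

count : (Var → Bool) → Mono → ℕ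
count t []      = 0
count t (v ∷ μ) = if t v then suc (count t μ) else count t μ

if-cong : ∀ {A : Set} d {a a′ e e′ : A} → a ≡ a′ → e ≡ e′ → (if d then a else e) ≡ (if d then a′ else e′)
if-cong d refl refl = refl

count-here : ∀ {t : Var → Bool} v μ → t v ≡ true → count t (v ∷ μ) ≡ suc (count t μ)
count-here {t} v μ tv rewrite tv = refl

count-there : ∀ {t : Var → Bool} v μ → t v ≡ false → count t (v ∷ μ) ≡ count t μ
count-there {t} v μ tv rewrite tv = refl

count-++ : ∀ t μ ν → count t (μ ++ ν) ≡ count t μ + count t ν
count-++ t []      ν = refl
count-++ t (v ∷ μ) ν with t v
... | true  = cong suc (count-++ t μ ν)
... | false = count-++ t μ ν

count-map : ∀ t g μ → count t (map g μ) ≡ count (t ∘ g) μ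
count-map t g []      = refl
count-map t g (v ∷ μ) = if-cong (t (g v)) (cong suc (count-map t g μ)) (count-map t g μ)

count-cong : ∀ {t t′} → (∀ v → t v ≡ t′ v) → ∀ μ → count t μ ≡ count t′ μ
count-cong eq []      = refl
count-cong {t} eq (v ∷ μ) rewrite eq v = if-cong _ (cong suc (count-cong eq μ)) (count-cong eq μ)

_==_ : Var → Var → Bool
v == w = ⌊ v ≟V w ⌋

expo≡count : ∀ v μ → expo v μ ≡ count (v ==_) μ
expo≡count v []      = refl
expo≡count v (w ∷ μ) = if-cong (v == w) (cong suc (expo≡count v μ)) (expo≡count v μ)

==-refl : ∀ v → (v == v) ≡ true
==-refl v = trans (isYes≗does (v ≟V v)) (dec-true (v ≟V v) refl)

==-≢ : ∀ {v w} → v ≢ w → (v == w) ≡ false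
==-≢ {v} {w} v≢w = trans (isYes≗does (v ≟V w)) (dec-false (v ≟V w) v≢w)

expo-here : ∀ v μ → expo v (v ∷ μ) ≡ suc (expo v μ)
expo-here v μ rewrite expo≡count v (v ∷ μ) | expo≡count v μ = count-here v μ (==-refl v)

expo-there : ∀ {v w} μ → v ≢ w → expo v (w ∷ μ) ≡ expo v μ
expo-there {v} {w} μ v≢w rewrite expo≡count v (w ∷ μ) | expo≡count v μ = count-there w μ (==-≢ v≢w)

expo-++ : ∀ v μ ν → expo v (μ ++ ν) ≡ expo v μ + expo v ν
expo-++ v μ ν rewrite expo≡count v (μ ++ ν) | expo≡count v μ | expo≡count v ν = count-++ (v ==_) μ ν

==-shift : ∀ p v w → (shift p v == shift p w) ≡ (v == w)
==-shift p v w with v ≟V w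
... | yes refl = ==-refl (shift p v)
... | no v≢w   = ==-≢ (v≢w ∘ shift-injective p)

expo-shift : ∀ p v μ → expo (shift p v) (map (shift p) μ) ≡ expo v μ
expo-shift p v μ rewrite expo≡count (shift p v) (map (shift p) μ) | expo≡count v μ =
  trans (count-map _ (shift p) μ) (count-cong (==-shift p v) μ)

below at above : ℕ → Mono → ℕ
below m = count (λ v → level v ≤ᵇ m)
at    m = count (λ v → level v ≡ᵇ m)
above m = count (λ v → m ≤ᵇ level v)

private
  ≤ᵇ-cancelʳ : ∀ p m n → (m + p ≤ᵇ n + p) ≡ (m ≤ᵇ n)
  ≤ᵇ-cancelʳ p m n = does-⇔ (mk⇔ (+-cancelʳ-≤ p m n) (+-monoˡ-≤ p)) (m + p ≤? n + p) (m ≤? n)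

  ≡ᵇ-cancelʳ : ∀ p m n → (m + p ≡ᵇ n + p) ≡ (m ≡ᵇ n)
  ≡ᵇ-cancelʳ p m n = does-⇔ (mk⇔ (+-cancelʳ-≡ p m n) (cong (_+ p))) (m + p ≟ n + p) (m ≟ n)

  count-shift : ∀ (t t′ : ℕ → Bool) p → (∀ l → t (l + p) ≡ t′ l) → ∀ μ →
                count (t ∘ level) (map (shift p) μ) ≡ count (t′ ∘ level) μ
  count-shift t t′ p eq μ =
    trans (count-map _ (shift p) μ) (count-cong (λ v → trans (cong t (level-shift p v)) (eq (level v))) μ)

below-shift : ∀ p k μ → below (k + p) (map (shift p) μ) ≡ below k μ
below-shift p k = count-shift (_≤ᵇ k + p) (_≤ᵇ k) p (λ l → ≤ᵇ-cancelʳ p l k)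

at-shift : ∀ p k μ → at (k + p) (map (shift p) μ) ≡ at k μ
at-shift p k = count-shift (_≡ᵇ k + p) (_≡ᵇ k) p (λ l → ≡ᵇ-cancelʳ p l k)

above-shift : ∀ p k μ → above (k + p) (map (shift p) μ) ≡ above k μ
above-shift p k = count-shift (k + p ≤ᵇ_) (k ≤ᵇ_) p (λ l → ≤ᵇ-cancelʳ p k l)

Distinct : List Var → Set
Distinct = AllPairs _≢_

Σexpo : List Var → Mono → ℕ
Σexpo vs μ = sum (map (λ v → expo v μ) vs)

count-split : ∀ (t u : Var → Bool) μ → count t μ ≡ count (λ w → u w ∧ t w) μ + count (λ w → not (u w) ∧ t w) μ
count-split t u []      = refl
count-split t u (w ∷ μ) with u w | t w
... | true  | true  = cong suc (count-split t u μ)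
... | true  | false = count-split t u μ
... | false | true  = trans (cong suc (count-split t u μ)) (sym (+-suc _ _))
... | false | false = count-split t u μ

private
  count-==∧ : ∀ {t : Var → Bool} v μ → t v ≡ true → count (λ w → (v == w) ∧ t w) μ ≡ expo v μ
  count-==∧ v [] tv = refl
  count-==∧ {t} v (w ∷ μ) tv with v ≟V w
  ... | yes refl rewrite tv = cong suc (count-==∧ v μ tv)
  ... | no _     = count-==∧ v μ tv

Σexpo≤count : ∀ {t : Var → Bool} vs μ → Distinct vs → All (λ v → t v ≡ true) vs →
              Σexpo vs μ ≤ count t μ
Σexpo≤count []       μ []          []          = z≤n
Σexpo≤count {t} (v ∷ vs) μ (v∉vs ∷ dvs) (tv ∷ tvs) = begin
  expo v μ + Σexpo vs μ ≤⟨ +-monoʳ-≤ (expo v μ) (Σexpo≤count vs μ dvs (All.zipWith others (v∉vs , tvs))) ⟩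
  expo v μ + count t′ μ                    ≡⟨ cong (_+ count t′ μ) (sym (count-==∧ v μ tv)) ⟩
  count (λ w → (v == w) ∧ t w) μ + count t′ μ ≡⟨ sym (count-split t (v ==_) μ) ⟩
  count t μ                                ∎
  where
  open ≤-Reasoning
  t′ : Var → Bool
  t′ w = not (v == w) ∧ t w
  others : ∀ {w} → v ≢ w × t w ≡ true → t′ w ≡ true
  others (v≢w , tw) rewrite ==-≢ v≢w = tw

expo≤count : ∀ {t : Var → Bool} v μ → t v ≡ true → expo v μ ≤ count t μ
expo≤count v μ tv = subst (_≤ _) (+-identityʳ (expo v μ)) (Σexpo≤count (v ∷ []) μ ([] ∷ []) (tv ∷ []))

expo-excluded : ∀ {t : Var → Bool} v vs μ → Distinct (v ∷ vs) → All (λ w → t w ≡ true) (v ∷ vs) →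
                count t μ ≡ Σexpo vs μ → expo v μ ≡ 0
expo-excluded v vs μ d a eq =
  n≤0⇒n≡0 (+-cancelʳ-≤ (Σexpo vs μ) (expo v μ) 0 (subst (_ ≤_) eq (Σexpo≤count (v ∷ vs) μ d a)))

expo≢0⇒∈ : ∀ v μ → expo v μ ≢ 0 → v ∈ μ
expo≢0⇒∈ v []      h = ⊥-elim (h refl)
expo≢0⇒∈ v (w ∷ μ) h with v ≟V w
... | yes refl = here refl
... | no v≢w   = there (expo≢0⇒∈ v μ h)

private
  count-middle : ∀ t w μ ν → count t (μ ++ w ∷ ν) ≡ count t (w ∷ μ ++ ν)
  count-middle t w μ ν with t w in tw
  ... | true  = trans (count-++ t μ (w ∷ ν)) (trans (cong (count t μ +_) (count-here w ν tw))
                  (trans (+-suc _ _) (cong suc (sym (count-++ t μ ν)))))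
  ... | false = trans (count-++ t μ (w ∷ ν)) (trans (cong (count t μ +_) (count-there w ν tw))
                  (sym (count-++ t μ ν)))

  expo-∷-cancel : ∀ v w μ ν → expo v (w ∷ μ) ≡ expo v (w ∷ ν) → expo v μ ≡ expo v ν
  expo-∷-cancel v w μ ν eq with v ≟V w
  ... | yes refl = suc-injective eq
  ... | no _     = eq

count-resp : ∀ t {μ ν} → μ ≈M ν → count t μ ≡ count t ν
count-resp t {[]} {[]}    eq = refl
count-resp t {[]} {w ∷ ν} eq = ⊥-elim (0≢1+n (trans (eq w) (expo-here w ν)))
count-resp t {w ∷ μ} {ν}  eq
  with ν₁ , ν₂ , refl ← ∈-∃++ (expo≢0⇒∈ w ν (λ z → 0≢1+n (trans (sym z) (trans (sym (eq w)) (expo-here w μ)))))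
  = trans (if-cong (t w) (cong suc rest) rest) (sym (count-middle t w ν₁ ν₂))
  where
  μ≈ν₁ν₂ : μ ≈M (ν₁ ++ ν₂)
  μ≈ν₁ν₂ v = expo-∷-cancel v w μ (ν₁ ++ ν₂) (trans (eq v)
    (trans (expo≡count v (ν₁ ++ w ∷ ν₂)) (trans (count-middle (v ==_) w ν₁ ν₂) (sym (expo≡count v (w ∷ ν₁ ++ ν₂))))))
  rest : count t μ ≡ count t (ν₁ ++ ν₂)
  rest = count-resp t {μ} {ν₁ ++ ν₂} μ≈ν₁ν₂

count-mono : ∀ {t t′ : Var → Bool} → (∀ v → t v ≡ true → t′ v ≡ true) → ∀ μ → count t μ ≤ count t′ μ
count-mono h [] = z≤n
count-mono {t} {t′} h (v ∷ μ) with t v in tv | t′ v in t′v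
... | true  | true  = s≤s (count-mono h μ)
... | true  | false = ⊥-elim (true≢false (trans (sym (h v tv)) t′v))
... | false | true  = m≤n⇒m≤1+n (count-mono h μ)
... | false | false = count-mono h μ

below-suc : ∀ p μ → below (suc p) μ ≡ below p μ + at (suc p) μ
below-suc p μ = trans (count-split _ (λ v → level v ≤ᵇ p) μ)
  (cong₂ _+_ (count-cong (λ v → lower (level v)) μ) (count-cong (λ v → top (level v)) μ))
  where
  lower : ∀ l → ((l ≤ᵇ p) ∧ (l ≤ᵇ suc p)) ≡ (l ≤ᵇ p)
  lower l = does-⇔ (mk⇔ proj₁ (λ l≤p → l≤p , m≤n⇒m≤1+n l≤p)) ((l ≤? p) ×-dec (l ≤? suc p)) (l ≤? p)
  top : ∀ l → (not (l ≤ᵇ p) ∧ (l ≤ᵇ suc p)) ≡ (l ≡ᵇ suc p)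
  top l = does-⇔ (mk⇔ to from) (¬? (l ≤? p) ×-dec (l ≤? suc p)) (l ≟ suc p)
    where
    to : ¬ l ≤ p × l ≤ suc p → l ≡ suc p
    to (l≰p , l≤1+p) with m≤n⇒m<n∨m≡n l≤1+p
    ... | inj₁ l<1+p = ⊥-elim (l≰p (m<1+n⇒m≤n l<1+p))
    ... | inj₂ l≡1+p = l≡1+p
    from : l ≡ suc p → ¬ l ≤ p × l ≤ suc p
    from refl = 1+n≰n , ≤-refl

Σexpo-++ : ∀ vs μ ν → Σexpo vs (μ ++ ν) ≡ Σexpo vs μ + Σexpo vs ν
Σexpo-++ []       μ ν = refl
Σexpo-++ (v ∷ vs) μ ν rewrite expo-++ v μ ν | Σexpo-++ vs μ ν = interchange (expo v μ) (expo v ν) _ _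

Σexpo-resp : ∀ vs {μ ν} → μ ≈M ν → Σexpo vs μ ≡ Σexpo vs ν
Σexpo-resp []       eq = refl
Σexpo-resp (v ∷ vs) {μ} {ν} eq = cong₂ _+_ (eq v) (Σexpo-resp vs {μ} {ν} eq)

Σexpo-shift : ∀ p vs μ → Σexpo (map (shift p) vs) (map (shift p) μ) ≡ Σexpo vs μ
Σexpo-shift p []       μ = refl
Σexpo-shift p (v ∷ vs) μ = cong₂ _+_ (expo-shift p v μ) (Σexpo-shift p vs μ)

below-resp : ∀ m {μ ν} → μ ≈M ν → below m μ ≡ below m ν
below-resp m {μ} {ν} = count-resp (λ v → level v ≤ᵇ m) {μ} {ν}

at-resp : ∀ m {μ ν} → μ ≈M ν → at m μ ≡ at m ν
at-resp m {μ} {ν} = count-resp (λ v → level v ≡ᵇ m) {μ} {ν}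

above-resp : ∀ m {μ ν} → μ ≈M ν → above m μ ≡ above m ν
above-resp m {μ} {ν} = count-resp (λ v → m ≤ᵇ level v) {μ} {ν}

expo-replicate : ∀ v k → expo v (replicate k v) ≡ k
expo-replicate v zero    = refl
expo-replicate v (suc k) = trans (expo-here v (replicate k v)) (cong suc (expo-replicate v k))

expo-replicate-≢ : ∀ {v w} k → v ≢ w → expo v (replicate k w) ≡ 0
expo-replicate-≢ zero    v≢w = refl
expo-replicate-≢ {v} {w} (suc k) v≢w = trans (expo-there (replicate k w) v≢w) (expo-replicate-≢ k v≢w)

≤⇒≤ᵇ≡true : ∀ {l m} → l ≤ m → (l ≤ᵇ m) ≡ true
≤⇒≤ᵇ≡true = Equivalence.to T-≡ ∘ ≤⇒≤ᵇ

≡⇒≡ᵇ≡true : ∀ {l m} → l ≡ m → (l ≡ᵇ m) ≡ true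
≡⇒≡ᵇ≡true {l} {m} = Equivalence.to T-≡ ∘ ≡⇒≡ᵇ l m

below-excluded : ∀ {m} {μ} v ws → Distinct (v ∷ ws) → All (λ w → level w ≤ m) (v ∷ ws) →
                 below m μ ≡ Σexpo ws μ → expo v μ ≡ 0
below-excluded {m} {μ} v ws d ls = expo-excluded {t = λ w → level w ≤ᵇ m} v ws μ d (All.map ≤⇒≤ᵇ≡true ls)

at-excluded : ∀ {m μ} v ws → Distinct (v ∷ ws) → All (λ w → level w ≡ m) (v ∷ ws) →
              at m μ ≡ Σexpo ws μ → expo v μ ≡ 0
at-excluded {m} {μ} v ws d ls = expo-excluded {t = λ w → level w ≡ᵇ m} v ws μ d (All.map ≡⇒≡ᵇ≡true ls)

below-zero⇒expo-zero : ∀ {m} μ v → below m μ ≡ 0 → level v ≤ m → expo v μ ≡ 0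
below-zero⇒expo-zero {m} μ v h lv = n≤0⇒n≡0 (subst (expo v μ ≤_) h (expo≤count {t = λ w → level w ≤ᵇ m} v μ (≤⇒≤ᵇ≡true lv)))

above-zero⇒expo-zero : ∀ {m} μ v → above m μ ≡ 0 → m ≤ level v → expo v μ ≡ 0
above-zero⇒expo-zero {m} μ v h lv = n≤0⇒n≡0 (subst (expo v μ ≤_) h (expo≤count {t = λ w → m ≤ᵇ level w} v μ (≤⇒≤ᵇ≡true lv)))

above-suc-≤ : ∀ m μ → above (suc m) μ ≤ above m μ
above-suc-≤ m = count-mono (λ v h → ≤⇒≤ᵇ≡true (≤-trans (n≤1+n m) (≤ᵇ⇒≤ (suc m) (level v) (Equivalence.from T-≡ h))))

at-≤-above : ∀ m μ → at m μ ≤ above m μ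
at-≤-above m = count-mono (λ v h → ≤⇒≤ᵇ≡true (≤-reflexive (sym (≡ᵇ⇒≡ (level v) m (Equivalence.from T-≡ h)))))

below-singleton : ∀ {m v} → level v ≤ m → below m (v ∷ []) ≡ 1
below-singleton {m} {v} lv = count-here {t = λ w → level w ≤ᵇ m} v [] (≤⇒≤ᵇ≡true lv)

≈M?-sound : ∀ μ ν → (μ ≈M? ν) ≡ true → μ ≈M ν
≈M?-sound μ ν h v with All.all? (λ w → expo w μ ≟ expo w ν) (μ ++ ν) | expo v (μ ++ ν) ≟ 0
... | yes agree | yes v∉ = trans (m+n≡0⇒m≡0 _ v∉′) (sym (m+n≡0⇒n≡0 _ v∉′))
  where v∉′ = trans (sym (expo-++ v μ ν)) v∉
... | yes agree | no v∈  = All.lookup agree (expo≢0⇒∈ v (μ ++ ν) v∈)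

≈M?-complete : ∀ μ ν → μ ≈M ν → (μ ≈M? ν) ≡ true
≈M?-complete μ ν eq with All.all? (λ w → expo w μ ≟ expo w ν) (μ ++ ν)
... | yes _         = refl
... | no disagree   = ⊥-elim (disagree (All.tabulate (λ {w} _ → eq w)))

≈M?-resp : ∀ {μ ν} κ → μ ≈M ν → (μ ≈M? κ) ≡ (ν ≈M? κ)
≈M?-resp {μ} {ν} κ eq with μ ≈M? κ in μκ | ν ≈M? κ in νκ
... | true  | true  = refl
... | false | false = refl
... | true  | false = ⊥-elim (true≢false (trans (sym (≈M?-complete ν κ (λ v → trans (sym (eq v)) (≈M?-sound μ κ μκ v)))) νκ))
... | false | true  = ⊥-elim (true≢false (trans (sym (≈M?-complete μ κ (λ v → trans (eq v) (≈M?-sound ν κ νκ v)))) μκ))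

mono-≈P : ∀ {μ ν} → μ ≈M ν → mono μ ≈P mono ν
mono-≈P eq κ = cong (λ d → if d then true else false) (≈M?-resp κ eq)

∣P⇒expo : ∀ {v α} → mono (v ∷ []) ∣P mono α → 1 ≤ expo v α
∣P⇒expo {v} {α} (t , eq) with expo v α in v∉α
... | suc _ = s≤s z≤n
... | zero  = ⊥-elim (true≢false (trans (sym (cong (λ d → if d then true else false) (≈M?-complete α α (λ _ → refl))))
                                         (trans (eq α) (no-multiple t))))
  where
  no-multiple : ∀ t → coeff (mono (v ∷ []) *P t) α ≡ false
  no-multiple []      = refl
  no-multiple (m ∷ t) with (v ∷ m) ≈M? α in vm≈α
  ... | true  = ⊥-elim (0≢1+n (trans (sym v∉α) (trans (sym (≈M?-sound (v ∷ m) α vm≈α v)) (expo-here v m))))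
  ... | false = no-multiple t

parityOf : (Mono → Bool) → Poly → Bool
parityOf t = foldr (λ μ acc → if t μ then not acc else acc) false

parityOf-∷ : ∀ t μ p → parityOf t (μ ∷ p) ≡ t μ xor parityOf t p
parityOf-∷ t μ p with t μ
... | true  = refl
... | false = refl

parityOf-++ : ∀ t p r → parityOf t (p ++ r) ≡ parityOf t p xor parityOf t r
parityOf-++ t []      r = refl
parityOf-++ t (μ ∷ p) r = begin
  parityOf t (μ ∷ p ++ r)                        ≡⟨ parityOf-∷ t μ (p ++ r) ⟩
  t μ xor parityOf t (p ++ r)                    ≡⟨ cong (t μ xor_) (parityOf-++ t p r) ⟩
  t μ xor (parityOf t p xor parityOf t r)        ≡⟨ sym (xor-assoc (t μ) _ _) ⟩
  (t μ xor parityOf t p) xor parityOf t r        ≡⟨ cong (_xor parityOf t r) (sym (parityOf-∷ t μ p)) ⟩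
  parityOf t (μ ∷ p) xor parityOf t r            ∎
  where open ≡-Reasoning

parityOf-middle : ∀ t p₁ μ p₂ → parityOf t (p₁ ++ μ ∷ p₂) ≡ t μ xor parityOf t (p₁ ++ p₂)
parityOf-middle t p₁ μ p₂ = begin
  parityOf t (p₁ ++ μ ∷ p₂)                      ≡⟨ parityOf-++ t p₁ (μ ∷ p₂) ⟩
  parityOf t p₁ xor parityOf t (μ ∷ p₂)          ≡⟨ cong (parityOf t p₁ xor_) (parityOf-∷ t μ p₂) ⟩
  parityOf t p₁ xor (t μ xor parityOf t p₂)      ≡⟨ sym (xor-assoc (parityOf t p₁) _ _) ⟩
  (parityOf t p₁ xor t μ) xor parityOf t p₂      ≡⟨ cong (_xor parityOf t p₂) (xor-comm (parityOf t p₁) (t μ)) ⟩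
  (t μ xor parityOf t p₁) xor parityOf t p₂      ≡⟨ xor-assoc (t μ) _ _ ⟩
  t μ xor (parityOf t p₁ xor parityOf t p₂)      ≡⟨ cong (t μ xor_) (sym (parityOf-++ t p₁ p₂)) ⟩
  t μ xor parityOf t (p₁ ++ p₂)                  ∎
  where open ≡-Reasoning

coeff-split : ∀ p κ → coeff p κ ≡ true → ∃₂ λ p₁ p₂ → ∃ λ μ → p ≡ p₁ ++ μ ∷ p₂ × (μ ≈M? κ) ≡ true
coeff-split (μ ∷ p) κ h with μ ≈M? κ in μ≈κ
... | true  = [] , p , μ , refl , μ≈κ
... | false with p₁ , p₂ , μ′ , refl , μ′≈κ ← coeff-split p κ h = μ ∷ p₁ , p₂ , μ′ , refl , μ′≈κ

private
  xor-cancel : ∀ a {d} → a xor (a xor d) ≡ d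
  xor-cancel a {d} = trans (sym (xor-assoc a a d)) (cong (_xor d) (xor-same a))

  xor≡false⇒≡ : ∀ {x y} → x xor y ≡ false → x ≡ y
  xor≡false⇒≡ {false} h = sym h
  xor≡false⇒≡ {true}  {true} h = refl

  null-partner : ∀ μ p → coeff (μ ∷ p) μ ≡ false → coeff p μ ≡ true
  null-partner μ p null with μ ≈M? μ in μ≈μ | coeff p μ
  ... | _     | true  = refl
  ... | true  | false = sym null
  ... | false | false = sym (trans (sym (≈M?-complete μ μ (λ _ → refl))) μ≈μ)

BinomialInvariant : (Mono → Bool) → Poly → Set
BinomialInvariant G g = ∃₂ λ ξ ξ′ → g ≡ ξ ∷ ξ′ ∷ [] × ∀ u → G (u ++ ξ) ≡ G (u ++ ξ′)

module _ (G : Mono → Bool) (G-resp : ∀ {μ ν} → μ ≈M ν → G μ ≡ G ν) where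

  parity-null : ∀ n p → length p ≤ n → (∀ κ → coeff p κ ≡ false) → parityOf G p ≡ false
  parity-null n       []      _         _    = refl
  parity-null (suc n) (μ ∷ p) (s≤s len) null
    with p₁ , p₂ , μ′ , refl , μ′≈μ ← coeff-split p μ (null-partner μ p (null μ))
    = begin
      parityOf G (μ ∷ p₁ ++ μ′ ∷ p₂)      ≡⟨ parityOf-∷ G μ (p₁ ++ μ′ ∷ p₂) ⟩
      G μ xor parityOf G (p₁ ++ μ′ ∷ p₂)  ≡⟨ cong (G μ xor_) (parityOf-middle G p₁ μ′ p₂) ⟩
      G μ xor (G μ′ xor rest)             ≡⟨ cong (λ g → G μ xor (g xor rest)) (G-resp {μ′} {μ} μ′≈μ′) ⟩
      G μ xor (G μ xor rest)              ≡⟨ xor-cancel (G μ) ⟩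
      rest                                ≡⟨ parity-null n (p₁ ++ p₂) shorter null′ ⟩
      false                               ∎
    where
    open ≡-Reasoning
    rest = parityOf G (p₁ ++ p₂)
    μ′≈μ′ : μ′ ≈M μ
    μ′≈μ′ = ≈M?-sound μ′ μ μ′≈μ
    shorter : length (p₁ ++ p₂) ≤ n
    shorter = ≤-trans (n≤1+n _) (subst (_≤ n) (trans (length-++ p₁) (trans (+-suc _ _) (cong suc (sym (length-++ p₁))))) len)
    null′ : ∀ κ → coeff (p₁ ++ p₂) κ ≡ false
    null′ κ = begin
      coeff (p₁ ++ p₂) κ                           ≡⟨ sym (xor-cancel (μ ≈M? κ)) ⟩
      (μ ≈M? κ) xor ((μ ≈M? κ) xor coeff (p₁ ++ p₂) κ)  ≡⟨ cong (λ g → (μ ≈M? κ) xor (g xor coeff (p₁ ++ p₂) κ))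
                                                              (sym (≈M?-resp {μ′} {μ} κ μ′≈μ′)) ⟩
      (μ ≈M? κ) xor ((μ′ ≈M? κ) xor coeff (p₁ ++ p₂) κ) ≡⟨ cong ((μ ≈M? κ) xor_) (sym (parityOf-middle (_≈M? κ) p₁ μ′ p₂)) ⟩
      (μ ≈M? κ) xor coeff (p₁ ++ μ′ ∷ p₂) κ        ≡⟨ sym (parityOf-∷ (_≈M? κ) μ (p₁ ++ μ′ ∷ p₂)) ⟩
      coeff (μ ∷ p₁ ++ μ′ ∷ p₂) κ                  ≡⟨ null κ ⟩
      false                                        ∎

  parity-product : ∀ {ξ ξ′} r → (∀ u → G (u ++ ξ) ≡ G (u ++ ξ′)) → parityOf G (r *P (ξ ∷ ξ′ ∷ [])) ≡ false
  parity-product []      _   = refl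
  parity-product {ξ} {ξ′} (u ∷ r) inv = begin
    parityOf G ((u ++ ξ) ∷ (u ++ ξ′) ∷ rest)          ≡⟨ parityOf-∷ G (u ++ ξ) ((u ++ ξ′) ∷ rest) ⟩
    G (u ++ ξ) xor parityOf G ((u ++ ξ′) ∷ rest)      ≡⟨ cong (G (u ++ ξ) xor_) (parityOf-∷ G (u ++ ξ′) rest) ⟩
    G (u ++ ξ) xor (G (u ++ ξ′) xor parityOf G rest)  ≡⟨ cong₂ (λ g h → g xor (G (u ++ ξ′) xor h)) (inv u) (parity-product r inv) ⟩
    G (u ++ ξ′) xor (G (u ++ ξ′) xor false)           ≡⟨ xor-cancel (G (u ++ ξ′)) ⟩
    false                                             ∎
    where
    open ≡-Reasoning
    rest = r *P (ξ ∷ ξ′ ∷ [])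

  parity-lincomb : ∀ {Gs} rs → (∀ {g} → g ∈ Gs → BinomialInvariant G g) → All (λ rg → proj₂ rg ∈ Gs) rs →
                   parityOf G (lincomb rs) ≡ false
  parity-lincomb []             _   []         = refl
  parity-lincomb ((r , g) ∷ rs) inv (g∈ ∷ gs∈) with ξ , ξ′ , refl , inv-ξ ← inv g∈ =
    trans (parityOf-++ G (r *P (ξ ∷ ξ′ ∷ [])) (lincomb rs))
          (cong₂ _xor_ (parity-product r inv-ξ) (parity-lincomb rs inv gs∈))

  binomial-ideal-invariant : ∀ {Gs μ ν} → (∀ {g} → g ∈ Gs → BinomialInvariant G g) → (mono μ +P mono ν) ∈⟨ Gs ⟩ → G μ ≡ G ν
  binomial-ideal-invariant {Gs} {μ} {ν} inv (rs , gs∈ , eq) = xor≡false⇒≡ (begin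
    G μ xor G ν                                  ≡⟨ cong (G μ xor_) (sym (trans (parityOf-∷ G ν []) (xor-identityʳ (G ν)))) ⟩
    G μ xor parityOf G (ν ∷ [])                  ≡⟨ sym (parityOf-∷ G μ (ν ∷ [])) ⟩
    parityOf G (μ ∷ ν ∷ [])                      ≡⟨ sym (xor-identityʳ _) ⟩
    parityOf G (μ ∷ ν ∷ []) xor false            ≡⟨ cong (parityOf G (μ ∷ ν ∷ []) xor_) (sym (parity-lincomb rs inv gs∈)) ⟩
    parityOf G (μ ∷ ν ∷ []) xor parityOf G ideal ≡⟨ sym (parityOf-++ G (μ ∷ ν ∷ []) ideal) ⟩
    parityOf G (μ ∷ ν ∷ ideal)                   ≡⟨ parity-null _ (μ ∷ ν ∷ ideal) ≤-refl cancelled ⟩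
    false                                        ∎)
    where
    open ≡-Reasoning
    ideal = lincomb rs
    cancelled : ∀ κ → coeff (μ ∷ ν ∷ ideal) κ ≡ false
    cancelled κ = trans (parityOf-++ (_≈M? κ) (μ ∷ ν ∷ []) ideal)
                        (trans (cong (_xor coeff ideal κ) (eq κ)) (xor-same (coeff ideal κ)))

data Phase : Set where
  ϕ₁ ϕ₂ ϕ₃ ϕ₄ : Phase

ix : Phase → ℕ
ix ϕ₁ = 1
ix ϕ₂ = 2
ix ϕ₃ = 3
ix ϕ₄ = 4

private
  phase : ℕ → Phase
  phase 1 = ϕ₁
  phase 2 = ϕ₂
  phase 3 = ϕ₃
  phase _ = ϕ₄

  phase-ix : ∀ r → phase (ix r) ≡ r
  phase-ix ϕ₁ = refl
  phase-ix ϕ₂ = refl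
  phase-ix ϕ₃ = refl
  phase-ix ϕ₄ = refl

ix-injective : ∀ {r r′} → ix r ≡ ix r′ → r ≡ r′
ix-injective {r} {r′} eq = trans (sym (phase-ix r)) (trans (cong phase eq) (phase-ix r′))

q-injective : ∀ {k k′ i} → q k i ≡ q k′ i → k ≡ k′
q-injective refl = refl

c-injective : ∀ {k k′ i} → c k i ≡ c k′ i → k ≡ k′
c-injective refl = refl

_≟ᵖ_ : (r r′ : Phase) → Dec (r ≡ r′)
r ≟ᵖ r′ = map′ ix-injective (cong ix) (ix r ≟ ix r′)

any-phase? : ∀ {A : Phase → Set} → (∀ r → Dec (A r)) → Dec (∃ A)
any-phase? {A} A? = map′ from to (((A? ϕ₁ ⊎-dec A? ϕ₂) ⊎-dec A? ϕ₃) ⊎-dec A? ϕ₄)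
  where
  from : ((A ϕ₁ ⊎ A ϕ₂) ⊎ A ϕ₃) ⊎ A ϕ₄ → ∃ A
  from (inj₁ (inj₁ (inj₁ a))) = ϕ₁ , a
  from (inj₁ (inj₁ (inj₂ a))) = ϕ₂ , a
  from (inj₁ (inj₂ a))        = ϕ₃ , a
  from (inj₂ a)               = ϕ₄ , a
  to : ∃ A → ((A ϕ₁ ⊎ A ϕ₂) ⊎ A ϕ₃) ⊎ A ϕ₄
  to (ϕ₁ , a) = inj₁ (inj₁ (inj₁ a))
  to (ϕ₂ , a) = inj₁ (inj₁ (inj₂ a))
  to (ϕ₃ , a) = inj₁ (inj₂ a)
  to (ϕ₄ , a) = inj₂ a

all-phases? : ∀ {A : Phase → Set} → (∀ r → Dec (A r)) → Dec (∀ r → A r)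
all-phases? {A} A? = map′ from to (A? ϕ₁ ×-dec A? ϕ₂ ×-dec A? ϕ₃ ×-dec A? ϕ₄)
  where
  from : A ϕ₁ × A ϕ₂ × A ϕ₃ × A ϕ₄ → ∀ r → A r
  from (a₁ , _ , _ , _) ϕ₁ = a₁
  from (_ , a₂ , _ , _) ϕ₂ = a₂
  from (_ , _ , a₃ , _) ϕ₃ = a₃
  from (_ , _ , _ , a₄) ϕ₄ = a₄
  to : (∀ r → A r) → A ϕ₁ × A ϕ₂ × A ϕ₃ × A ϕ₄
  to a = a ϕ₁ , a ϕ₂ , a ϕ₃ , a ϕ₄

bs : ℕ → Mono → Phase → ℕ
bs p μ r = expo (b (ix r) p) μ

bvars : ℕ → List Var
bvars p = b 1 p ∷ b 2 p ∷ b 3 p ∷ b 4 p ∷ []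

bsum : ℕ → Mono → ℕ
bsum p = Σexpo (bvars p)

-- Progress P of the level-(p+1) machine in phase r, where E = e p, y k is the exponent of
-- b_{k,p} and π the progress of the level-p machine.
Counter : Phase → ℕ → (Phase → ℕ) → ℕ → ℕ → Set
Counter ϕ₁ E y π P = y ϕ₂ ≡ 0 × y ϕ₃ ≡ 0 × y ϕ₁ + y ϕ₄ ≡ π × P ≡ E * y ϕ₄
Counter ϕ₂ E y π P = y ϕ₂ + y ϕ₃ ≡ π × suc (y ϕ₁ + y ϕ₄) ≡ E × P ≡ E * y ϕ₄ + y ϕ₃
Counter ϕ₃ E y π P = y ϕ₂ + y ϕ₃ ≡ π × suc (y ϕ₁ + y ϕ₄) ≡ E × P + y ϕ₂ ≡ E + E * y ϕ₄
Counter ϕ₄ E y π P = y ϕ₂ ≡ 0 × y ϕ₃ ≡ 0 × y ϕ₁ + y ϕ₄ ≡ π × P + E * y ϕ₁ ≡ E * E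

Counter-functional : ∀ r {E y π P P′} → Counter r E y π P → Counter r E y π P′ → P ≡ P′
Counter-functional ϕ₁ (_ , _ , _ , P≡) (_ , _ , _ , P′≡) = trans P≡ (sym P′≡)
Counter-functional ϕ₂ (_ , _ , P≡) (_ , _ , P′≡)         = trans P≡ (sym P′≡)
Counter-functional ϕ₃ (_ , _ , P≡) (_ , _ , P′≡)         = +-cancelʳ-≡ _ _ _ (trans P≡ (sym P′≡))
Counter-functional ϕ₄ (_ , _ , _ , P≡) (_ , _ , _ , P′≡) = +-cancelʳ-≡ _ _ _ (trans P≡ (sym P′≡))

Counter? : ∀ r E y π → Dec (∃ (Counter r E y π))
Counter? ϕ₁ E y π = map′ (λ (h₂ , h₃ , h₁₄) → E * y ϕ₄ , h₂ , h₃ , h₁₄ , refl) (λ (_ , h₂ , h₃ , h₁₄ , _) → h₂ , h₃ , h₁₄)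
  (y ϕ₂ ≟ 0 ×-dec y ϕ₃ ≟ 0 ×-dec y ϕ₁ + y ϕ₄ ≟ π)
Counter? ϕ₂ E y π = map′ (λ (h₂₃ , h₁₄) → E * y ϕ₄ + y ϕ₃ , h₂₃ , h₁₄ , refl) (λ (_ , h₂₃ , h₁₄ , _) → h₂₃ , h₁₄)
  (y ϕ₂ + y ϕ₃ ≟ π ×-dec suc (y ϕ₁ + y ϕ₄) ≟ E)
Counter? ϕ₃ E y π = map′ (λ (h₂₃ , h₁₄ , le) → E + E * y ϕ₄ ∸ y ϕ₂ , h₂₃ , h₁₄ , m∸n+n≡m le)
  (λ (P , h₂₃ , h₁₄ , h) → h₂₃ , h₁₄ , subst (y ϕ₂ ≤_) h (m≤n+m (y ϕ₂) P))
  (y ϕ₂ + y ϕ₃ ≟ π ×-dec suc (y ϕ₁ + y ϕ₄) ≟ E ×-dec y ϕ₂ ≤? E + E * y ϕ₄)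
Counter? ϕ₄ E y π = map′ (λ (h₂ , h₃ , h₁₄ , le) → E * E ∸ E * y ϕ₁ , h₂ , h₃ , h₁₄ , m∸n+n≡m le)
  (λ (P , h₂ , h₃ , h₁₄ , h) → h₂ , h₃ , h₁₄ , subst (E * y ϕ₁ ≤_) h (m≤n+m (E * y ϕ₁) P))
  (y ϕ₂ ≟ 0 ×-dec y ϕ₃ ≟ 0 ×-dec y ϕ₁ + y ϕ₄ ≟ π ×-dec E * y ϕ₁ ≤? E * E)

data Terminal : Set where
  start finish : Terminal

terminalVar : Terminal → ℕ → Var
terminalVar start  = s
terminalVar finish = f

terminalValue : Terminal → ℕ → ℕ
terminalValue start  _ = 0
terminalValue finish m = e m

-- Config m μ P: the variables of μ of level ≤ m encode a level-m configuration of progress P.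
data Config : ℕ → Mono → ℕ → Set
record Running (r : Phase) (p : ℕ) (μ : Mono) (P : ℕ) : Set

data Config where
  terminal : ∀ {m μ} t → expo (terminalVar t m) μ ≡ 1 → below m μ ≡ 1 → Config m μ (terminalValue t m)
  running  : ∀ {p μ P} r → Running r p μ P → Config (suc p) μ P

record Running r p μ P where
  inductive
  field
    q-once  : expo (q (ix r) (suc p)) μ ≡ 1
    c-once  : expo (c (ix r) p) μ ≡ 1
    layer   : at (suc p) μ ≡ 2 + bsum p μ
    {π}     : ℕ
    sub     : Config p μ π
    counter : Counter r (e p) (bs p μ) π P

level-terminalVar : ∀ t m → level (terminalVar t m) ≡ m
level-terminalVar start  m = refl
level-terminalVar finish m = refl

terminal-excludes : ∀ {m} μ t v → expo (terminalVar t m) μ ≡ 1 → below m μ ≡ 1 →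
                    level v ≤ m → v ≢ terminalVar t m → expo v μ ≡ 0
terminal-excludes {m} μ t v t≡1 below≡1 lv v≢t =
  below-excluded {m} {μ} v (terminalVar t m ∷ []) ((v≢t ∷ []) ∷ [] ∷ []) (lv ∷ ≤-reflexive (level-terminalVar t m) ∷ [])
    (trans below≡1 (cong (_+ 0) (sym t≡1)))

layerVars : Phase → ℕ → List Var
layerVars r p = q (ix r) (suc p) ∷ c (ix r) p ∷ bvars p

bvars-distinct : ∀ p → Distinct (bvars p)
bvars-distinct p = ((λ ()) ∷ (λ ()) ∷ (λ ()) ∷ []) ∷ ((λ ()) ∷ (λ ()) ∷ []) ∷ ((λ ()) ∷ []) ∷ [] ∷ []

layer-excludes : ∀ {p} μ r v → expo (q (ix r) (suc p)) μ ≡ 1 → expo (c (ix r) p) μ ≡ 1 →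
                 at (suc p) μ ≡ 2 + bsum p μ → level v ≡ suc p → All (v ≢_) (layerVars r p) → expo v μ ≡ 0
layer-excludes {p} μ r v q≡1 c≡1 layer lv v∉ =
  at-excluded {suc p} {μ} v (layerVars r p) (v∉ ∷ layer-distinct) (lv ∷ refl ∷ refl ∷ refl ∷ refl ∷ refl ∷ refl ∷ [])
    (trans layer (sym (cong₂ (λ m n → m + (n + bsum p μ)) q≡1 c≡1)))
  where
  layer-distinct : Distinct (layerVars r p)
  layer-distinct = ((λ ()) ∷ (λ ()) ∷ (λ ()) ∷ (λ ()) ∷ (λ ()) ∷ [])
                 ∷ ((λ ()) ∷ (λ ()) ∷ (λ ()) ∷ (λ ()) ∷ []) ∷ bvars-distinct p

private
  1≤⇒≢0 : ∀ {n} → 1 ≤ n → n ≢ 0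
  1≤⇒≢0 (s≤s _) ()

terminal-inv : ∀ {m μ P} t → Config m μ P → 1 ≤ expo (terminalVar t m) μ → P ≡ terminalValue t m × below m μ ≡ 1
terminal-inv start  (terminal start  _ below≡1) _ = refl , below≡1
terminal-inv finish (terminal finish _ below≡1) _ = refl , below≡1
terminal-inv {m} {μ} start (terminal finish f≡1 below≡1) s≥1 =
  ⊥-elim (1≤⇒≢0 s≥1 (terminal-excludes {m} μ finish (s m) f≡1 below≡1 ≤-refl (λ ())))
terminal-inv {m} {μ} finish (terminal start s≡1 below≡1) f≥1 =
  ⊥-elim (1≤⇒≢0 f≥1 (terminal-excludes {m} μ start (f m) s≡1 below≡1 ≤-refl (λ ())))
terminal-inv {_} {μ} t (running {p} r R) t≥1 =
  ⊥-elim (1≤⇒≢0 t≥1 (layer-excludes {p} μ r (terminalVar t (suc p)) q-once c-once layer (level-terminalVar t _) (not-layer t)))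
  where
  open Running R
  not-layer : ∀ t → All (terminalVar t (suc p) ≢_) (layerVars r p)
  not-layer start  = (λ ()) ∷ (λ ()) ∷ (λ ()) ∷ (λ ()) ∷ (λ ()) ∷ (λ ()) ∷ []
  not-layer finish = (λ ()) ∷ (λ ()) ∷ (λ ()) ∷ (λ ()) ∷ (λ ()) ∷ (λ ()) ∷ []

running-inv : ∀ {p μ P} r → Config (suc p) μ P → 1 ≤ expo (q (ix r) (suc p)) μ → Running r p μ P
running-inv {p} {μ} r (terminal t t≡1 below≡1) q≥1 =
  ⊥-elim (1≤⇒≢0 q≥1 (terminal-excludes {suc p} μ t (q (ix r) (suc p)) t≡1 below≡1 ≤-refl (q≢t t)))
  where
  q≢t : ∀ t → q (ix r) (suc p) ≢ terminalVar t (suc p)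
  q≢t start  ()
  q≢t finish ()
running-inv r (running r′ R) q≥1 with r ≟ᵖ r′
running-inv r (running r′ R) q≥1 | yes refl = R
running-inv {p} {μ} r (running r′ R) q≥1 | no r≢r′ =
  ⊥-elim (1≤⇒≢0 q≥1 (layer-excludes {p} μ r′ (q (ix r) (suc p)) q-once c-once layer refl
           ((r≢r′ ∘ ix-injective ∘ q-injective) ∷ (λ ()) ∷ (λ ()) ∷ (λ ()) ∷ (λ ()) ∷ (λ ()) ∷ [])))
  where
  open Running R

Config-functional : ∀ {m μ P P′} → Config m μ P → Config m μ P′ → P ≡ P′
Config-functional (terminal t t≡1 _) C′ = sym (proj₁ (terminal-inv t C′ (≤-reflexive (sym t≡1))))
Config-functional (running r R) C′ with running-inv r C′ (≤-reflexive (sym (Running.q-once R)))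
... | R′ with Config-functional (Running.sub R) (Running.sub R′)
...   | refl = Counter-functional r (Running.counter R) (Running.counter R′)

private
  Terminated : ℕ → Mono → Set
  Terminated m μ = ∃ λ t → expo (terminalVar t m) μ ≡ 1 × below m μ ≡ 1

  terminated? : ∀ m μ → Dec (Terminated m μ)
  terminated? m μ = map′ from to ((expo (s m) μ ≟ 1 ×-dec below m μ ≟ 1) ⊎-dec (expo (f m) μ ≟ 1 ×-dec below m μ ≟ 1))
    where
    from : _ → Terminated m μ
    from (inj₁ h) = start , h
    from (inj₂ h) = finish , h
    to : Terminated m μ → _
    to (start  , h) = inj₁ h
    to (finish , h) = inj₂ h

Config? : ∀ m μ → Dec (∃ (Config m μ))
running? : ∀ r p μ → Dec (∃ (Running r p μ))

Config? zero μ = map′ (λ (t , h₁ , h₂) → _ , terminal t h₁ h₂) to (terminated? 0 μ)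
  where
  to : ∃ (Config 0 μ) → Terminated 0 μ
  to (_ , terminal t h₁ h₂) = t , h₁ , h₂
Config? (suc p) μ = map′ from to (terminated? (suc p) μ ⊎-dec any-phase? (λ r → running? r p μ))
  where
  from : Terminated (suc p) μ ⊎ ∃ (λ r → ∃ (Running r p μ)) → ∃ (Config (suc p) μ)
  from (inj₁ (t , h₁ , h₂)) = _ , terminal t h₁ h₂
  from (inj₂ (r , _ , R))   = _ , running r R
  to : ∃ (Config (suc p) μ) → Terminated (suc p) μ ⊎ ∃ (λ r → ∃ (Running r p μ))
  to (_ , terminal t h₁ h₂) = inj₁ (t , h₁ , h₂)
  to (_ , running r R)      = inj₂ (r , _ , R)

running? r p μ with expo (q (ix r) (suc p)) μ ≟ 1 ×-dec expo (c (ix r) p) μ ≟ 1 ×-dec at (suc p) μ ≟ 2 + bsum p μ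
                  | Config? p μ
... | no ¬h | _     = no λ (_ , R) → ¬h (Running.q-once R , Running.c-once R , Running.layer R)
... | yes _ | no ¬C = no λ (_ , R) → ¬C (_ , Running.sub R)
... | yes (q≡1 , c≡1 , l) | yes (π , C) with Counter? r (e p) (bs p μ) π
...   | yes (P , ctr) = yes (P , record { q-once = q≡1 ; c-once = c≡1 ; layer = l ; sub = C ; counter = ctr })
...   | no ¬ctr       = no λ (P , R) → ¬ctr (P , subst (λ π′ → Counter r (e p) (bs p μ) π′ P)
                                                 (Config-functional (Running.sub R) C) (Running.counter R))

Counter-cong : ∀ r {E y y′ π P} → (∀ k → y k ≡ y′ k) → Counter r E y π P → Counter r E y′ π P
Counter-cong ϕ₁ eq C rewrite sym (eq ϕ₁) | sym (eq ϕ₂) | sym (eq ϕ₃) | sym (eq ϕ₄) = C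
Counter-cong ϕ₂ eq C rewrite sym (eq ϕ₁) | sym (eq ϕ₂) | sym (eq ϕ₃) | sym (eq ϕ₄) = C
Counter-cong ϕ₃ eq C rewrite sym (eq ϕ₁) | sym (eq ϕ₂) | sym (eq ϕ₃) | sym (eq ϕ₄) = C
Counter-cong ϕ₄ eq C rewrite sym (eq ϕ₁) | sym (eq ϕ₂) | sym (eq ϕ₃) | sym (eq ϕ₄) = C

Config-resp : ∀ {m μ ν P} → μ ≈M ν → Config m μ P → Config m ν P
Config-resp {m} {μ} {ν} eq (terminal t t≡1 below≡1) =
  terminal t (trans (sym (eq _)) t≡1) (trans (sym (below-resp m {μ} {ν} eq)) below≡1)
Config-resp {suc p} {μ} {ν} eq (running r R) = running r (record
  { q-once  = trans (sym (eq _)) q-once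
  ; c-once  = trans (sym (eq _)) c-once
  ; layer   = trans (sym (at-resp (suc p) {μ} {ν} eq)) (trans layer (cong (2 +_) (Σexpo-resp (bvars p) {μ} {ν} eq)))
  ; sub     = Config-resp eq sub
  ; counter = Counter-cong r (λ k → eq _) counter
  })
  where open Running R

private
  moved-sum : ∀ {a a′ o π π′} → a + o ≡ π → π + a′ ≡ π′ + a → a′ + o ≡ π′
  moved-sum {a} {a′} {o} {π} {π′} h bal = +-cancelʳ-≡ a _ _ (begin
    a′ + o + a     ≡⟨ +-assoc a′ o a ⟩
    a′ + (o + a)   ≡⟨ cong (a′ +_) (trans (+-comm o a) h) ⟩
    a′ + π         ≡⟨ +-comm a′ π ⟩
    π + a′         ≡⟨ bal ⟩
    π′ + a         ∎)
    where open ≡-Reasoning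

  moved-sum′ : ∀ {a a′ o π π′} → o + a ≡ π → π + a′ ≡ π′ + a → o + a′ ≡ π′
  moved-sum′ {a} {a′} {o} h bal = trans (+-comm o a′) (moved-sum (trans (+-comm a o) h) bal)

Counter-transfer : ∀ r {E y y′ π π′ P} → (∀ k → k ≢ r → y′ k ≡ y k) → π + y′ r ≡ π′ + y r →
                   Counter r E y π P → Counter r E y′ π′ P
Counter-transfer ϕ₁ same bal (h₂ , h₃ , h₁₄ , hP)
  rewrite same ϕ₂ (λ ()) | same ϕ₃ (λ ()) | same ϕ₄ (λ ()) = h₂ , h₃ , moved-sum h₁₄ bal , hP
Counter-transfer ϕ₂ same bal (h₂₃ , h₁₄ , hP)
  rewrite same ϕ₁ (λ ()) | same ϕ₃ (λ ()) | same ϕ₄ (λ ()) = moved-sum h₂₃ bal , h₁₄ , hP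
Counter-transfer ϕ₃ same bal (h₂₃ , h₁₄ , hP)
  rewrite same ϕ₁ (λ ()) | same ϕ₂ (λ ()) | same ϕ₄ (λ ()) = moved-sum′ h₂₃ bal , h₁₄ , hP
Counter-transfer ϕ₄ same bal (h₂ , h₃ , h₁₄ , hP)
  rewrite same ϕ₁ (λ ()) | same ϕ₂ (λ ()) | same ϕ₃ (λ ()) = h₂ , h₃ , moved-sum′ h₁₄ bal , hP

e-suc : ∀ p → e (suc p) ≡ e p * e p
e-suc p = trans (cong (2 ^_) (cong (2 ^ p +_) (+-identityʳ (2 ^ p)))) (^-distribˡ-+-* 2 (2 ^ p) (2 ^ p))

δ : Phase → Phase → ℕ
δ ϕ₁ ϕ₁ = 1
δ ϕ₂ ϕ₂ = 1
δ ϕ₃ ϕ₃ = 1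
δ ϕ₄ ϕ₄ = 1
δ _  _  = 0

private
  +≡0 : ∀ {m n} → m + n ≡ 0 → m ≡ 0 × n ≡ 0
  +≡0 {m} eq = m+n≡0⇒m≡0 m eq , m+n≡0⇒n≡0 m eq

leave-start : ∀ {E} y {P} → Counter ϕ₁ E y 0 P → (∀ j → y j ≡ 0) × P ≡ 0
leave-start {E} y (y₂≡0 , y₃≡0 , y₁₄≡0 , P≡) = all-zero , trans P≡ (trans (cong (E *_) y₄≡0) (*-zeroʳ E))
  where
  y₄≡0 = proj₂ (+≡0 y₁₄≡0)
  all-zero : ∀ j → y j ≡ 0
  all-zero ϕ₁ = proj₁ (+≡0 y₁₄≡0)
  all-zero ϕ₂ = y₂≡0
  all-zero ϕ₃ = y₃≡0
  all-zero ϕ₄ = y₄≡0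

enter-start : ∀ E → Counter ϕ₁ E (λ _ → 0) 0 0
enter-start E = refl , refl , refl , sym (*-zeroʳ E)

leave-finish : ∀ p y {P} → Counter ϕ₄ (e p) y 0 P → (∀ j → y j ≡ 0) × P ≡ e (suc p)
leave-finish p y {P} (y₂≡0 , y₃≡0 , y₁₄≡0 , hP) = all-zero , P≡
  where
  y₁≡0 = proj₁ (+≡0 y₁₄≡0)
  all-zero : ∀ j → y j ≡ 0
  all-zero ϕ₁ = y₁≡0
  all-zero ϕ₂ = y₂≡0
  all-zero ϕ₃ = y₃≡0
  all-zero ϕ₄ = proj₂ (+≡0 y₁₄≡0)
  P≡ : P ≡ e (suc p)
  P≡ = begin
    P                 ≡⟨ sym (+-identityʳ P) ⟩
    P + 0             ≡⟨ cong (P +_) (sym (trans (cong (e p *_) y₁≡0) (*-zeroʳ (e p)))) ⟩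
    P + e p * y ϕ₁    ≡⟨ hP ⟩
    e p * e p         ≡⟨ sym (e-suc p) ⟩
    e (suc p)         ∎
    where open ≡-Reasoning

enter-finish : ∀ p → Counter ϕ₄ (e p) (λ _ → 0) 0 (e (suc p))
enter-finish p = refl , refl , refl , trans (cong (e (suc p) +_) (*-zeroʳ (e p))) (trans (+-identityʳ _) (e-suc p))

module _ {E : ℕ} (y : Phase → ℕ) {P : ℕ} where

  private
    y₁ = y ϕ₁
    y₂ = y ϕ₂
    y₃ = y ϕ₃
    y₄ = y ϕ₄

  ϕ₂⇒ϕ₁ : Counter ϕ₂ E y 0 P → Counter ϕ₁ E (λ j → δ ϕ₁ j + y j) E P
  ϕ₂⇒ϕ₁ (h₂₃ , h₁₄ , hP) = y₂≡0 , y₃≡0 , h₁₄ , trans hP (trans (cong (E * y₄ +_) y₃≡0) (+-identityʳ _))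
    where y₂≡0 = proj₁ (+≡0 h₂₃) ; y₃≡0 = proj₂ (+≡0 h₂₃)

  ϕ₁⇒ϕ₂ : Counter ϕ₁ E (λ j → δ ϕ₁ j + y j) E P → Counter ϕ₂ E y 0 P
  ϕ₁⇒ϕ₂ (y₂≡0 , y₃≡0 , h₁₄ , hP) =
    cong₂ _+_ y₂≡0 y₃≡0 , h₁₄ , trans hP (sym (trans (cong (E * y₄ +_) y₃≡0) (+-identityʳ _)))

  ϕ₃⇒ϕ₂ : Counter ϕ₃ E y E P → Counter ϕ₂ E y E P
  ϕ₃⇒ϕ₂ (h₂₃ , h₁₄ , hP) = h₂₃ , h₁₄ , +-cancelʳ-≡ y₂ P (E * y₄ + y₃) (begin
    P + y₂              ≡⟨ hP ⟩
    E + E * y₄          ≡⟨ cong (_+ E * y₄) (sym h₂₃) ⟩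
    (y₂ + y₃) + E * y₄  ≡⟨ lemma y₂ y₃ (E * y₄) ⟩
    (E * y₄ + y₃) + y₂  ∎)
    where
    open ≡-Reasoning
    lemma : ∀ a b c → (a + b) + c ≡ (c + b) + a
    lemma = solve-∀

  ϕ₂⇒ϕ₃ : Counter ϕ₂ E y E P → Counter ϕ₃ E y E P
  ϕ₂⇒ϕ₃ (h₂₃ , h₁₄ , hP) = h₂₃ , h₁₄ , (begin
    P + y₂              ≡⟨ cong (_+ y₂) hP ⟩
    (E * y₄ + y₃) + y₂  ≡⟨ lemma (E * y₄) y₃ y₂ ⟩
    (y₂ + y₃) + E * y₄  ≡⟨ cong (_+ E * y₄) h₂₃ ⟩
    E + E * y₄          ∎)
    where
    open ≡-Reasoning
    lemma : ∀ a b c → (a + b) + c ≡ (c + b) + a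
    lemma = solve-∀

  b₁⇒b₄ : Counter ϕ₃ E (λ j → δ ϕ₁ j + y j) 0 P → Counter ϕ₂ E (λ j → δ ϕ₄ j + y j) 0 P
  b₁⇒b₄ (h₂₃ , h₁₄ , hP) = h₂₃ , trans (cong suc (+-suc y₁ y₄)) h₁₄ , (begin
    P                   ≡⟨ sym (+-identityʳ P) ⟩
    P + 0               ≡⟨ cong (P +_) (sym y₂≡0) ⟩
    P + y₂              ≡⟨ hP ⟩
    E + E * y₄          ≡⟨ sym (*-suc E y₄) ⟩
    E * suc y₄          ≡⟨ sym (+-identityʳ _) ⟩
    E * suc y₄ + 0      ≡⟨ cong (E * suc y₄ +_) (sym y₃≡0) ⟩
    E * suc y₄ + y₃     ∎)
    where
    open ≡-Reasoning
    y₂≡0 = proj₁ (+≡0 h₂₃) ; y₃≡0 = proj₂ (+≡0 h₂₃)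

  b₄⇒b₁ : Counter ϕ₂ E (λ j → δ ϕ₄ j + y j) 0 P → Counter ϕ₃ E (λ j → δ ϕ₁ j + y j) 0 P
  b₄⇒b₁ (h₂₃ , h₁₄ , hP) = h₂₃ , trans (cong suc (sym (+-suc y₁ y₄))) h₁₄ , (begin
    P + y₂              ≡⟨ cong₂ _+_ hP y₂≡0 ⟩
    (E * suc y₄ + y₃) + 0 ≡⟨ +-identityʳ _ ⟩
    E * suc y₄ + y₃     ≡⟨ cong (E * suc y₄ +_) y₃≡0 ⟩
    E * suc y₄ + 0      ≡⟨ +-identityʳ _ ⟩
    E * suc y₄          ≡⟨ *-suc E y₄ ⟩
    E + E * y₄          ∎)
    where
    open ≡-Reasoning
    y₂≡0 = proj₁ (+≡0 h₂₃) ; y₃≡0 = proj₂ (+≡0 h₂₃)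

  ϕ₄⇒ϕ₃ : Counter ϕ₄ E (λ j → δ ϕ₄ j + y j) E P → Counter ϕ₃ E y 0 P
  ϕ₄⇒ϕ₃ (y₂≡0 , y₃≡0 , h₁₄ , hP) = cong₂ _+_ y₂≡0 y₃≡0 , trans (sym (+-suc y₁ y₄)) h₁₄ , (begin
    P + y₂              ≡⟨ cong (P +_) y₂≡0 ⟩
    P + 0               ≡⟨ +-identityʳ P ⟩
    P                   ≡⟨ +-cancelʳ-≡ (E * y₁) P (E * suc y₄) P+Ey₁ ⟩
    E * suc y₄          ≡⟨ *-suc E y₄ ⟩
    E + E * y₄          ∎)
    where
    open ≡-Reasoning
    P+Ey₁ : P + E * y₁ ≡ E * suc y₄ + E * y₁
    P+Ey₁ = begin
      P + E * y₁               ≡⟨ hP ⟩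
      E * E                    ≡⟨ cong (E *_) (sym h₁₄) ⟩
      E * (y₁ + suc y₄)        ≡⟨ *-distribˡ-+ E y₁ (suc y₄) ⟩
      E * y₁ + E * suc y₄      ≡⟨ +-comm (E * y₁) _ ⟩
      E * suc y₄ + E * y₁      ∎

  ϕ₃⇒ϕ₄ : Counter ϕ₃ E y 0 P → Counter ϕ₄ E (λ j → δ ϕ₄ j + y j) E P
  ϕ₃⇒ϕ₄ (h₂₃ , h₁₄ , hP) = y₂≡0 , y₃≡0 , trans (+-suc y₁ y₄) h₁₄ , (begin
    P + E * y₁               ≡⟨ cong (_+ E * y₁) P≡ ⟩
    E * suc y₄ + E * y₁      ≡⟨ +-comm _ (E * y₁) ⟩
    E * y₁ + E * suc y₄      ≡⟨ sym (*-distribˡ-+ E y₁ (suc y₄)) ⟩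
    E * (y₁ + suc y₄)        ≡⟨ cong (E *_) (trans (+-suc y₁ y₄) h₁₄) ⟩
    E * E                    ∎)
    where
    open ≡-Reasoning
    y₂≡0 = proj₁ (+≡0 h₂₃) ; y₃≡0 = proj₂ (+≡0 h₂₃)
    P≡ : P ≡ E * suc y₄
    P≡ = trans (sym (+-identityʳ P)) (trans (cong (P +_) (sym y₂≡0)) (trans hP (sym (*-suc E y₄))))

  b₃⇒b₂ : Counter ϕ₂ E (λ j → δ ϕ₃ j + y j) E P → ∃ λ P′ → Counter ϕ₂ E (λ j → δ ϕ₂ j + y j) E P′ × P + 0 ≡ P′ + 1
  b₃⇒b₂ (h₂₃ , h₁₄ , hP) = E * y₄ + y₃ , (trans (sym (+-suc y₂ y₃)) h₂₃ , h₁₄ , refl) ,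
    trans (+-identityʳ P) (trans hP (trans (+-suc (E * y₄) y₃) (+-comm 1 _)))

  b₂⇒b₃ : Counter ϕ₂ E (λ j → δ ϕ₂ j + y j) E P → ∃ λ P′ → Counter ϕ₂ E (λ j → δ ϕ₃ j + y j) E P′ × P + 1 ≡ P′ + 0
  b₂⇒b₃ (h₂₃ , h₁₄ , hP) = suc P , (trans (+-suc y₂ y₃) h₂₃ , h₁₄ , trans (cong suc hP) (sym (+-suc (E * y₄) y₃))) ,
    trans (+-comm P 1) (sym (+-identityʳ (suc P)))

terminalVar-shift : ∀ p t → shift p (terminalVar t 0) ≡ terminalVar t p
terminalVar-shift p start  = refl
terminalVar-shift p finish = refl

-- x₀ is a closed side of a level-1 generator holding a phase-r configuration in level-0 state t
-- and k ∈ {0, 1} copies of c_{r,0}; the b_{2,0} ↔ b_{3,0} generators leave c_{2,0} in the multiplier.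
record Shape (r : Phase) (t : Terminal) (k : ℕ) (x₀ : Mono) : Set where
  field
    shape-q     : expo (q (ix r) 1) x₀ ≡ 1
    shape-c     : expo (c (ix r) 0) x₀ ≡ k
    shape-token : expo (terminalVar t 0) x₀ ≡ 1
    shape-below : below 0 x₀ ≡ 1
    shape-at    : at 1 x₀ ≡ suc k + bsum 0 x₀

shape? : ∀ r t k x₀ → Dec (Shape r t k x₀)
shape? r t k x₀ =
  map′ (λ (h₁ , h₂ , h₃ , h₄ , h₅) → record { shape-q = h₁ ; shape-c = h₂ ; shape-token = h₃ ; shape-below = h₄ ; shape-at = h₅ })
       (λ S → let open Shape S in shape-q , shape-c , shape-token , shape-below , shape-at)
       (expo (q (ix r) 1) x₀ ≟ 1 ×-dec expo (c (ix r) 0) x₀ ≟ k ×-dec expo (terminalVar t 0) x₀ ≟ 1 ×-dec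
        below 0 x₀ ≟ 1 ×-dec at 1 x₀ ≟ suc k + bsum 0 x₀)

-- The multiplier u of such a side: nothing of level ≤ p, and at level p+1 only b_{·,p} and the
-- 1 ∸ k copies of c_{r,p} not supplied by the side.
record Clear (p : ℕ) (r : Phase) (k : ℕ) (u : Mono) : Set where
  field
    below-zero : below p u ≡ 0
    c-count    : expo (c (ix r) p) u + k ≡ 1
    at-count   : at (suc p) u + k ≡ 1 + bsum p u

module Shifted (p : ℕ) (u x₀ : Mono) where

  X : Mono
  X = map (shift p) x₀

  expo-shifted : ∀ v → expo (shift p v) (u ++ X) ≡ expo (shift p v) u + expo v x₀
  expo-shifted v = trans (expo-++ (shift p v) u X) (cong (expo (shift p v) u +_) (expo-shift p v x₀))

  below-shifted : below p (u ++ X) ≡ below p u + below 0 x₀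
  below-shifted = trans (count-++ _ u X) (cong (below p u +_) (below-shift p 0 x₀))

  at-shifted : at (suc p) (u ++ X) ≡ at (suc p) u + at 1 x₀
  at-shifted = trans (count-++ _ u X) (cong (at (suc p) u +_) (at-shift p 1 x₀))

  bsum-shifted : bsum p (u ++ X) ≡ bsum p u + bsum 0 x₀
  bsum-shifted = trans (Σexpo-++ (bvars p) u X) (cong (bsum p u +_) (Σexpo-shift p (bvars 0) x₀))

  bs-shifted : ∀ j → bs p (u ++ X) j ≡ bs 0 x₀ j + bs p u j
  bs-shifted j = trans (expo-shifted (b (ix j) 0)) (+-comm (bs p u j) (bs 0 x₀ j))

terminal-view : ∀ {m u ν P} t → expo (terminalVar t m) ν ≡ 1 → below m ν ≡ 1 → Config m (u ++ ν) P →
                P ≡ terminalValue t m × below m u ≡ 0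
terminal-view {m} {u} {ν} t t≡1 below-ν C
  with P≡ , below≡1 ← terminal-inv t C (subst (1 ≤_) (sym (trans (expo-++ _ u ν) (cong (expo (terminalVar t m) u +_) t≡1))) (m≤n+m 1 _))
  = P≡ , +-cancelʳ-≡ 1 (below m u) 0 (trans (cong (below m u +_) (sym below-ν)) (trans (sym (count-++ _ u ν)) below≡1))

terminal-build : ∀ {m u ν} t → expo (terminalVar t m) ν ≡ 1 → below m ν ≡ 1 → below m u ≡ 0 → Config m (u ++ ν) (terminalValue t m)
terminal-build {m} {u} {ν} t t≡1 below-ν below-u = terminal t
  (trans (expo-++ _ u ν) (cong₂ _+_ (below-zero⇒expo-zero u _ below-u (≤-reflexive (level-terminalVar t m))) t≡1))
  (trans (count-++ _ u ν) (cong₂ _+_ below-u below-ν))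

running-view : ∀ {p u P} x₀ {r t k} → Shape r t k x₀ → Config (suc p) (u ++ map (shift p) x₀) P →
               Clear p r k u × Counter r (e p) (λ j → bs 0 x₀ j + bs p u j) (terminalValue t p) P
running-view {p} {u} {P} x₀ {r} {t} {k} S C = clear , counter′
  where
  open Shape S
  open Shifted p u x₀
  R : Running r p (u ++ X) P
  R = running-inv r C (subst (1 ≤_) (sym (trans (expo-shifted (q (ix r) 1)) (cong (_ +_) shape-q))) (m≤n+m 1 _))
  open Running R
  token≥1 : 1 ≤ expo (terminalVar t p) (u ++ X)
  token≥1 = subst (λ v → 1 ≤ expo v (u ++ X)) (terminalVar-shift p t)
              (subst (1 ≤_) (sym (trans (expo-shifted (terminalVar t 0)) (cong (_ +_) shape-token))) (m≤n+m 1 _))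
  sub-terminal = terminal-inv t sub token≥1
  layer′ : at (suc p) u + suc k + bsum 0 x₀ ≡ suc (suc (bsum p u)) + bsum 0 x₀
  layer′ = begin
    at (suc p) u + suc k + bsum 0 x₀     ≡⟨ +-assoc (at (suc p) u) (suc k) _ ⟩
    at (suc p) u + (suc k + bsum 0 x₀)   ≡⟨ cong (at (suc p) u +_) (sym shape-at) ⟩
    at (suc p) u + at 1 x₀               ≡⟨ sym at-shifted ⟩
    at (suc p) (u ++ X)                  ≡⟨ layer ⟩
    2 + bsum p (u ++ X)                  ≡⟨ cong (2 +_) bsum-shifted ⟩
    suc (suc (bsum p u)) + bsum 0 x₀     ∎
    where open ≡-Reasoning
  clear : Clear p r k u
  clear = record
    { below-zero = +-cancelʳ-≡ 1 (below p u) 0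
        (trans (cong (below p u +_) (sym shape-below)) (trans (sym below-shifted) (proj₂ sub-terminal)))
    ; c-count = trans (cong (expo (c (ix r) p) u +_) (sym shape-c)) (trans (sym (expo-shifted (c (ix r) 0))) c-once)
    ; at-count = suc-injective (trans (sym (+-suc (at (suc p) u) k)) (+-cancelʳ-≡ (bsum 0 x₀) _ _ layer′))
    }
  counter′ : Counter r (e p) (λ j → bs 0 x₀ j + bs p u j) (terminalValue t p) P
  counter′ = Counter-cong r bs-shifted (subst (λ π′ → Counter r (e p) (bs p (u ++ X)) π′ P) (proj₁ sub-terminal) counter)

running-build : ∀ {p u P} y₀ {r t k} → Shape r t k y₀ → Clear p r k u →
                Counter r (e p) (λ j → bs 0 y₀ j + bs p u j) (terminalValue t p) P → Config (suc p) (u ++ map (shift p) y₀) P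
running-build {p} {u} {P} y₀ {r} {t} {k} S K ctr = running r (record
  { q-once  = trans (expo-shifted (q (ix r) 1)) (cong₂ _+_ q-free shape-q)
  ; c-once  = trans (expo-shifted (c (ix r) 0)) (trans (cong (_ +_) shape-c) c-count)
  ; layer   = layer′
  ; sub     = terminal-build {p} {u} {X} t (trans (sym (cong (λ v → expo v X) (terminalVar-shift p t)))
                                      (trans (expo-shift p (terminalVar t 0) y₀) shape-token))
                               (trans (below-shift p 0 y₀) shape-below) below-zero
  ; counter = Counter-cong r (λ j → sym (bs-shifted j)) ctr
  })
  where
  open Shape S
  open Clear K
  open Shifted p u y₀
  at-u : at (suc p) u ≡ Σexpo (c (ix r) p ∷ bvars p) u
  at-u = +-cancelʳ-≡ k _ _ (begin
    at (suc p) u + k                        ≡⟨ at-count ⟩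
    1 + bsum p u                            ≡⟨ cong (_+ bsum p u) (sym c-count) ⟩
    expo (c (ix r) p) u + k + bsum p u      ≡⟨ +-assoc (expo (c (ix r) p) u) k _ ⟩
    expo (c (ix r) p) u + (k + bsum p u)    ≡⟨ cong (expo (c (ix r) p) u +_) (+-comm k _) ⟩
    expo (c (ix r) p) u + (bsum p u + k)    ≡⟨ sym (+-assoc (expo (c (ix r) p) u) _ k) ⟩
    expo (c (ix r) p) u + bsum p u + k      ∎)
    where open ≡-Reasoning
  q-free : expo (q (ix r) (suc p)) u ≡ 0
  q-free = at-excluded {suc p} {u} (q (ix r) (suc p)) (c (ix r) p ∷ bvars p)
             (((λ ()) ∷ (λ ()) ∷ (λ ()) ∷ (λ ()) ∷ (λ ()) ∷ []) ∷ ((λ ()) ∷ (λ ()) ∷ (λ ()) ∷ (λ ()) ∷ []) ∷ bvars-distinct p)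
             (refl ∷ refl ∷ refl ∷ refl ∷ refl ∷ refl ∷ []) at-u
  layer′ : at (suc p) (u ++ X) ≡ 2 + bsum p (u ++ X)
  layer′ = begin
    at (suc p) (u ++ X)                  ≡⟨ at-shifted ⟩
    at (suc p) u + at 1 y₀               ≡⟨ cong (at (suc p) u +_) shape-at ⟩
    at (suc p) u + (suc k + bsum 0 y₀)   ≡⟨ +-suc (at (suc p) u) _ ⟩
    suc (at (suc p) u + (k + bsum 0 y₀)) ≡⟨ cong suc (sym (+-assoc (at (suc p) u) k _)) ⟩
    suc (at (suc p) u + k + bsum 0 y₀)   ≡⟨ cong (λ n → suc (n + bsum 0 y₀)) at-count ⟩
    2 + (bsum p u + bsum 0 y₀)           ≡⟨ cong (2 +_) (sym bsum-shifted) ⟩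
    2 + bsum p (u ++ X)                  ∎
    where open ≡-Reasoning

bsum-zero : ∀ {p u} → (∀ j → bs p u j ≡ 0) → bsum p u ≡ 0
bsum-zero z rewrite z ϕ₁ | z ϕ₂ | z ϕ₃ | z ϕ₄ = refl

Clear-rephase : ∀ {p u} r r′ → Clear p r 1 u → Clear p r′ 1 u
Clear-rephase {p} {u} r r′ K = record
  { below-zero = below-zero
  ; c-count    = cong (_+ 1) (at-excluded {suc p} {u} (c (ix r′) p) (bvars p)
                   (((λ ()) ∷ (λ ()) ∷ (λ ()) ∷ (λ ()) ∷ []) ∷ bvars-distinct p) (refl ∷ refl ∷ refl ∷ refl ∷ refl ∷ [])
                   (suc-injective (trans (+-comm 1 _) at-count)))
  ; at-count   = at-count
  }
  where open Clear K

cleared : ∀ {p u} r → below (suc p) u ≡ 0 → Clear p r 1 u × (∀ j → bs p u j ≡ 0)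
cleared {p} {u} r below≡0 = record
  { below-zero = m+n≡0⇒m≡0 (below p u) split
  ; c-count    = cong (_+ 1) (below-zero⇒expo-zero u (c (ix r) p) below≡0 ≤-refl)
  ; at-count   = trans (cong (_+ 1) (m+n≡0⇒n≡0 (below p u) split)) (cong suc (sym (bsum-zero {p} {u} bs≡0)))
  } , bs≡0
  where
  split : below p u + at (suc p) u ≡ 0
  split = trans (sym (below-suc p u)) below≡0
  bs≡0 : ∀ j → bs p u j ≡ 0
  bs≡0 j = below-zero⇒expo-zero u (b (ix j) p) below≡0 ≤-refl

uncleared : ∀ {p u} r → Clear p r 1 u → (∀ j → bs p u j ≡ 0) → below (suc p) u ≡ 0
uncleared {p} {u} r K bs≡0 = trans (below-suc p u) (cong₂ _+_ below-zero at≡0)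
  where
  open Clear K
  at≡0 : at (suc p) u ≡ 0
  at≡0 = suc-injective (trans (+-comm 1 _) (trans at-count (cong suc (bsum-zero {p} {u} bs≡0))))

bsum-terminal : ∀ p t → bsum (suc p) (terminalVar t (suc p) ∷ []) ≡ 0
bsum-terminal p start  = refl
bsum-terminal p finish = refl

-- The progress of level m is traded against the b_{k,m} that the move consumes or produces.
ConfigStep : ℕ → Mono → Mono → Set
ConfigStep m ν ν′ = ∀ u {P} → Config m (u ++ ν) P → ∃ λ P′ → Config m (u ++ ν′) P′ × P + bsum m ν′ ≡ P′ + bsum m ν

running-step : ∀ {p} x₀ y₀ r r′ t t′ {k} {_ : True (shape? r t k x₀)} {_ : True (shape? r′ t′ k y₀)} →
               (∀ {u} → Clear p r k u → Clear p r′ k u) →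
               (∀ y {P} → Counter r (e p) (λ j → bs 0 x₀ j + y j) (terminalValue t p) P →
                  ∃ λ P′ → Counter r′ (e p) (λ j → bs 0 y₀ j + y j) (terminalValue t′ p) P′ × P + bsum 1 y₀ ≡ P′ + bsum 1 x₀) →
               ConfigStep (suc p) (map (shift p) x₀) (map (shift p) y₀)
running-step {p} x₀ y₀ r r′ t t′ {k} {x-shape} {y-shape} rephase arith u {P} C
  with K , ctr ← running-view x₀ (toWitness x-shape) C
  with P′ , ctr′ , balance ← arith (bs p u) ctr
  = P′ , running-build y₀ (toWitness y-shape) (rephase K) ctr′ ,
    subst₂ (λ m n → P + m ≡ P′ + n) (sym (Σexpo-shift p (bvars 1) y₀)) (sym (Σexpo-shift p (bvars 1) x₀)) balance

private
  terminal-alone : ∀ t m → expo (terminalVar t m) (terminalVar t m ∷ []) ≡ 1 × below m (terminalVar t m ∷ []) ≡ 1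
  terminal-alone t m = expo-here (terminalVar t m) [] , below-singleton {v = terminalVar t m} (≤-reflexive (level-terminalVar t m))

enter : ∀ {p} t y₀ r t′ {_ : True (shape? r t′ 1 y₀)} → bsum 1 y₀ ≡ 0 →
        Counter r (e p) (bs 0 y₀) (terminalValue t′ p) (terminalValue t (suc p)) →
        ConfigStep (suc p) (terminalVar t (suc p) ∷ []) (map (shift p) y₀)
enter {p} t y₀ r t′ {y-shape} no-b ctr u {P} C
  with P≡ , below≡0 ← terminal-view t (proj₁ (terminal-alone t (suc p))) (proj₂ (terminal-alone t (suc p))) C
  with K , bs≡0 ← cleared r below≡0
  = _ , running-build y₀ (toWitness y-shape) K (Counter-cong r (λ j → sym (trans (cong (_ +_) (bs≡0 j)) (+-identityʳ _)))
                                                  (subst (Counter r (e p) (bs 0 y₀) (terminalValue t′ p)) (sym P≡) ctr)) ,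
    cong (P +_) (trans (Σexpo-shift p (bvars 1) y₀) (trans no-b (sym (bsum-terminal p t))))

leave : ∀ {p} x₀ r t′ t {_ : True (shape? r t′ 1 x₀)} → bsum 1 x₀ ≡ 0 →
        (∀ y {P} → Counter r (e p) (λ j → bs 0 x₀ j + y j) (terminalValue t′ p) P →
                   (∀ j → y j ≡ 0) × P ≡ terminalValue t (suc p)) →
        ConfigStep (suc p) (map (shift p) x₀) (terminalVar t (suc p) ∷ [])
leave {p} x₀ r t′ t {x-shape} no-b arith u {P} C
  with K , ctr ← running-view x₀ (toWitness x-shape) C
  with bs≡0 , P≡ ← arith (bs p u) ctr
  = P , subst (Config (suc p) _) (sym P≡)
          (terminal-build t (proj₁ (terminal-alone t (suc p))) (proj₂ (terminal-alone t (suc p))) (uncleared r K bs≡0)) ,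
    cong (P +_) (trans (bsum-terminal p t) (sym (trans (Σexpo-shift p (bvars 1) x₀) no-b)))

own-step : ∀ p {x₀ y₀} → (x₀ ∷ y₀ ∷ []) ∈ 𝒫suc 0 →
           ConfigStep (suc p) (map (shift p) x₀) (map (shift p) y₀) × ConfigStep (suc p) (map (shift p) y₀) (map (shift p) x₀)
own-step p {x₀} {y₀} (here refl) =
  leave x₀ ϕ₁ start start refl (leave-start {e p}) , enter start x₀ ϕ₁ start refl (enter-start (e p))
own-step p {x₀} {y₀} (there (here refl)) =
  running-step x₀ y₀ ϕ₂ ϕ₁ start finish (Clear-rephase ϕ₂ ϕ₁) (λ y C → _ , ϕ₂⇒ϕ₁ y C , refl) ,
  running-step y₀ x₀ ϕ₁ ϕ₂ finish start (Clear-rephase ϕ₁ ϕ₂) (λ y C → _ , ϕ₁⇒ϕ₂ y C , refl)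
own-step p {x₀} {y₀} (there (there (here refl))) =
  running-step x₀ y₀ ϕ₃ ϕ₂ finish finish (Clear-rephase ϕ₃ ϕ₂) (λ y C → _ , ϕ₃⇒ϕ₂ y C , refl) ,
  running-step y₀ x₀ ϕ₂ ϕ₃ finish finish (Clear-rephase ϕ₂ ϕ₃) (λ y C → _ , ϕ₂⇒ϕ₃ y C , refl)
own-step p {x₀} {y₀} (there (there (there (here refl)))) =
  running-step x₀ y₀ ϕ₃ ϕ₂ start start (Clear-rephase ϕ₃ ϕ₂) (λ y C → _ , b₁⇒b₄ y C , refl) ,
  running-step y₀ x₀ ϕ₂ ϕ₃ start start (Clear-rephase ϕ₂ ϕ₃) (λ y C → _ , b₄⇒b₁ y C , refl)
own-step p {x₀} {y₀} (there (there (there (there (here refl))))) =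
  running-step x₀ y₀ ϕ₄ ϕ₃ finish start (Clear-rephase ϕ₄ ϕ₃) (λ y C → _ , ϕ₄⇒ϕ₃ y C , refl) ,
  running-step y₀ x₀ ϕ₃ ϕ₄ start finish (Clear-rephase ϕ₃ ϕ₄) (λ y C → _ , ϕ₃⇒ϕ₄ y C , refl)
own-step p {x₀} {y₀} (there (there (there (there (there (here refl)))))) =
  leave x₀ ϕ₄ start finish refl (leave-finish p) , enter finish x₀ ϕ₄ start refl (enter-finish p)
own-step p {x₀} {y₀} (there (there (there (there (there (there (here refl))))))) =
  running-step x₀ y₀ ϕ₂ ϕ₂ finish finish {0} id (b₃⇒b₂ {e p}) , running-step y₀ x₀ ϕ₂ ϕ₂ finish finish {0} id (b₂⇒b₃ {e p})
own-step p {x₀} {y₀} (there (there (there (there (there (there (there (here refl)))))))) =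
  running-step x₀ y₀ ϕ₂ ϕ₂ finish finish {0} id (b₃⇒b₂ {e p}) , running-step y₀ x₀ ϕ₂ ϕ₂ finish finish {0} id (b₂⇒b₃ {e p})
own-step p {x₀} {y₀} (there (there (there (there (there (there (there (there (here refl))))))))) =
  running-step x₀ y₀ ϕ₂ ϕ₂ finish finish {0} id (b₃⇒b₂ {e p}) , running-step y₀ x₀ ϕ₂ ϕ₂ finish finish {0} id (b₂⇒b₃ {e p})
own-step p {x₀} {y₀} (there (there (there (there (there (there (there (there (there (here refl)))))))))) =
  running-step x₀ y₀ ϕ₂ ϕ₂ finish finish {0} id (b₃⇒b₂ {e p}) , running-step y₀ x₀ ϕ₂ ϕ₂ finish finish {0} id (b₂⇒b₃ {e p})

-- A move of level m touches level m+1 only through the b_{k,m} next to a c_{k,m}, and nothing above.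
record Confined (m : ℕ) (ν ν′ : Mono) : Set where
  field
    empty-above     : above (2 + m) ν ≡ 0
    empty-above′    : above (2 + m) ν′ ≡ 0
    q-eq            : ∀ r → expo (q (ix r) (suc m)) ν ≡ expo (q (ix r) (suc m)) ν′
    c-eq            : ∀ r → expo (c (ix r) m) ν ≡ expo (c (ix r) m) ν′
    b-eq            : ∀ r → expo (c (ix r) m) ν ≡ 0 → bs m ν r ≡ bs m ν′ r
    at-balance      : at (suc m) ν + bsum m ν′ ≡ at (suc m) ν′ + bsum m ν
    nonempty-below  : 1 ≤ below m ν
    nonempty-below′ : 1 ≤ below m ν′

confined? : ∀ m ν ν′ → Dec (Confined m ν ν′)
confined? m ν ν′ = map′
  (λ (h₁ , h₂ , h₃ , h₄ , h₅ , h₆ , h₇ , h₈) → record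
     { empty-above = h₁ ; empty-above′ = h₂ ; q-eq = h₃ ; c-eq = h₄ ; b-eq = h₅ ; at-balance = h₆
     ; nonempty-below = h₇ ; nonempty-below′ = h₈ })
  (λ K → let open Confined K in empty-above , empty-above′ , q-eq , c-eq , b-eq , at-balance , nonempty-below , nonempty-below′)
  (above (2 + m) ν ≟ 0 ×-dec above (2 + m) ν′ ≟ 0 ×-dec
   all-phases? (λ r → expo (q (ix r) (suc m)) ν ≟ expo (q (ix r) (suc m)) ν′) ×-dec
   all-phases? (λ r → expo (c (ix r) m) ν ≟ expo (c (ix r) m) ν′) ×-dec
   all-phases? (λ r → expo (c (ix r) m) ν ≟ 0 →-dec bs m ν r ≟ bs m ν′ r) ×-dec
   at (suc m) ν + bsum m ν′ ≟ at (suc m) ν′ + bsum m ν ×-dec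
   1 ≤? below m ν ×-dec 1 ≤? below m ν′)

Confined-swap : ∀ {m ν ν′} → Confined m ν ν′ → Confined m ν′ ν
Confined-swap K = record
  { empty-above     = empty-above′
  ; empty-above′    = empty-above
  ; q-eq            = λ r → sym (q-eq r)
  ; c-eq            = λ r → sym (c-eq r)
  ; b-eq            = λ r c≡0 → sym (b-eq r (trans (c-eq r) c≡0))
  ; at-balance      = sym at-balance
  ; nonempty-below  = nonempty-below′
  ; nonempty-below′ = nonempty-below
  }
  where open Confined K

Confined-shift : ∀ p {x₀ y₀} → Confined 1 x₀ y₀ → Confined (suc p) (map (shift p) x₀) (map (shift p) y₀)
Confined-shift p {x₀} {y₀} K = record
  { empty-above     = trans (above-shift p 3 x₀) empty-above
  ; empty-above′    = trans (above-shift p 3 y₀) empty-above′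
  ; q-eq            = λ r → trans (expo-shift p (q (ix r) 2) x₀) (trans (q-eq r) (sym (expo-shift p (q (ix r) 2) y₀)))
  ; c-eq            = λ r → trans (expo-shift p (c (ix r) 1) x₀) (trans (c-eq r) (sym (expo-shift p (c (ix r) 1) y₀)))
  ; b-eq            = λ r c≡0 → trans (expo-shift p (b (ix r) 1) x₀)
                        (trans (b-eq r (trans (sym (expo-shift p (c (ix r) 1) x₀)) c≡0)) (sym (expo-shift p (b (ix r) 1) y₀)))
  ; at-balance      = subst₂ _≡_ (sym (cong₂ _+_ (at-shift p 2 x₀) (Σexpo-shift p (bvars 1) y₀)))
                        (sym (cong₂ _+_ (at-shift p 2 y₀) (Σexpo-shift p (bvars 1) x₀))) at-balance
  ; nonempty-below  = subst (1 ≤_) (sym (below-shift p 1 x₀)) nonempty-below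
  ; nonempty-below′ = subst (1 ≤_) (sym (below-shift p 1 y₀)) nonempty-below′
  }
  where open Confined K

private
  bsum-above : ∀ {m} μ → above (2 + m) μ ≡ 0 → bsum (suc m) μ ≡ 0
  bsum-above {m} μ h = bsum-zero {suc m} {μ} (λ j → above-zero⇒expo-zero μ (b (ix j) (suc m)) h ≤-refl)

Confined-lift : ∀ {m ν ν′} → Confined m ν ν′ → Confined (suc m) ν ν′
Confined-lift {m} {ν} {ν′} K = record
  { empty-above     = n≤0⇒n≡0 (subst (above (3 + m) ν ≤_) empty-above (above-suc-≤ (2 + m) ν))
  ; empty-above′    = n≤0⇒n≡0 (subst (above (3 + m) ν′ ≤_) empty-above′ (above-suc-≤ (2 + m) ν′))
  ; q-eq            = λ r → both-zero (q (ix r) (2 + m)) refl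
  ; c-eq            = λ r → both-zero (c (ix r) (suc m)) refl
  ; b-eq            = λ r _ → both-zero (b (ix r) (suc m)) refl
  ; at-balance      = trans (cong₂ _+_ (at-zero ν empty-above) (bsum-above ν′ empty-above′))
                            (sym (cong₂ _+_ (at-zero ν′ empty-above′) (bsum-above ν empty-above)))
  ; nonempty-below  = ≤-trans nonempty-below (below-≤ ν)
  ; nonempty-below′ = ≤-trans nonempty-below′ (below-≤ ν′)
  }
  where
  open Confined K
  both-zero : ∀ v → level v ≡ 2 + m → expo v ν ≡ expo v ν′
  both-zero v lv = trans (above-zero⇒expo-zero ν v empty-above (≤-reflexive (sym lv)))
                           (sym (above-zero⇒expo-zero ν′ v empty-above′ (≤-reflexive (sym lv))))
  at-zero : ∀ μ → above (2 + m) μ ≡ 0 → at (2 + m) μ ≡ 0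
  at-zero μ h = n≤0⇒n≡0 (subst (at (2 + m) μ ≤_) h (at-≤-above (2 + m) μ))
  below-≤ : ∀ μ → below m μ ≤ below (suc m) μ
  below-≤ μ = subst (below m μ ≤_) (sym (below-suc m μ)) (m≤m+n (below m μ) _)

bsum-balance : ∀ p r μ μ′ → (∀ k → k ≢ r → bs p μ′ k ≡ bs p μ k) → bsum p μ + bs p μ′ r ≡ bsum p μ′ + bs p μ r
bsum-balance p ϕ₁ μ μ′ same rewrite same ϕ₂ (λ ()) | same ϕ₃ (λ ()) | same ϕ₄ (λ ()) =
  lemma (bs p μ ϕ₁) (bs p μ′ ϕ₁) (bs p μ ϕ₂) (bs p μ ϕ₃) (bs p μ ϕ₄)
  where lemma : ∀ a a′ b c d → (a + (b + (c + (d + 0)))) + a′ ≡ (a′ + (b + (c + (d + 0)))) + a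
        lemma = solve-∀
bsum-balance p ϕ₂ μ μ′ same rewrite same ϕ₁ (λ ()) | same ϕ₃ (λ ()) | same ϕ₄ (λ ()) =
  lemma (bs p μ ϕ₂) (bs p μ′ ϕ₂) (bs p μ ϕ₁) (bs p μ ϕ₃) (bs p μ ϕ₄)
  where lemma : ∀ a a′ b c d → (b + (a + (c + (d + 0)))) + a′ ≡ (b + (a′ + (c + (d + 0)))) + a
        lemma = solve-∀
bsum-balance p ϕ₃ μ μ′ same rewrite same ϕ₁ (λ ()) | same ϕ₂ (λ ()) | same ϕ₄ (λ ()) =
  lemma (bs p μ ϕ₃) (bs p μ′ ϕ₃) (bs p μ ϕ₁) (bs p μ ϕ₂) (bs p μ ϕ₄)
  where lemma : ∀ a a′ b c d → (b + (c + (a + (d + 0)))) + a′ ≡ (b + (c + (a′ + (d + 0)))) + a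
        lemma = solve-∀
bsum-balance p ϕ₄ μ μ′ same rewrite same ϕ₁ (λ ()) | same ϕ₂ (λ ()) | same ϕ₃ (λ ()) =
  lemma (bs p μ ϕ₄) (bs p μ′ ϕ₄) (bs p μ ϕ₁) (bs p μ ϕ₂) (bs p μ ϕ₃)
  where lemma : ∀ a a′ b c d → (b + (c + (d + (a + 0)))) + a′ ≡ (b + (c + (d + (a′ + 0)))) + a
        lemma = solve-∀

layer-transfer : ∀ K {A a a′ B β β′} → A + a ≡ K + (B + β) → a + β′ ≡ a′ + β → A + a′ ≡ K + (B + β′)
layer-transfer K {A} {a} {a′} {B} {β} {β′} layer bal = +-cancelʳ-≡ β _ _ (begin
  A + a′ + β           ≡⟨ +-assoc A a′ β ⟩
  A + (a′ + β)         ≡⟨ cong (A +_) (sym bal) ⟩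
  A + (a + β′)         ≡⟨ sym (+-assoc A a β′) ⟩
  A + a + β′           ≡⟨ cong (_+ β′) layer ⟩
  K + (B + β) + β′     ≡⟨ lemma K B β β′ ⟩
  K + (B + β′) + β     ∎)
  where
  open ≡-Reasoning
  lemma : ∀ k m n o → k + (m + n) + o ≡ k + (m + o) + n
  lemma = solve-∀

balance-transfer : ∀ {π π′ β β′ γ γ′} U → π + β′ ≡ π′ + β → β + γ′ ≡ β′ + γ → π + (U + γ′) ≡ π′ + (U + γ)
balance-transfer {π} {π′} {β} {β′} {γ} {γ′} U bal bal′ = +-cancelʳ-≡ β _ _ (begin
  π + (U + γ′) + β     ≡⟨ lemma π U γ′ β ⟩
  U + (π + (β + γ′))   ≡⟨ cong (λ n → U + (π + n)) bal′ ⟩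
  U + (π + (β′ + γ))   ≡⟨ cong (U +_) (sym (+-assoc π β′ γ)) ⟩
  U + (π + β′ + γ)     ≡⟨ cong (λ n → U + (n + γ)) bal ⟩
  U + (π′ + β + γ)     ≡⟨ lemma′ U π′ β γ ⟩
  π′ + (U + γ) + β     ∎)
  where
  open ≡-Reasoning
  lemma : ∀ a b c d → a + (b + c) + d ≡ b + (a + (d + c))
  lemma = solve-∀
  lemma′ : ∀ a b c d → a + (b + c + d) ≡ b + (a + d) + c
  lemma′ = solve-∀

lift-step : ∀ {p ν ν′} → Confined p ν ν′ → ConfigStep p ν ν′ → ConfigStep (suc p) ν ν′
lift-step {p} {ν} {ν′} K step u (terminal t t≡1 below≡1) = ⊥-elim (1+n≰n (subst (2 ≤_) below≡1 two-low))
  where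
  open Confined K
  two-low : 2 ≤ below (suc p) (u ++ ν)
  two-low = begin
    1 + 1                                          ≤⟨ +-mono-≤ (≤-reflexive (sym t≡1)) nonempty-below ⟩
    expo (terminalVar t (suc p)) (u ++ ν) + below p ν ≤⟨ +-mono-≤ (expo≤count _ (u ++ ν) (≡⇒≡ᵇ≡true (level-terminalVar t (suc p))))
                                                                (subst (below p ν ≤_) (sym (count-++ _ u ν)) (m≤n+m _ _)) ⟩
    at (suc p) (u ++ ν) + below p (u ++ ν)         ≡⟨ +-comm (at (suc p) (u ++ ν)) _ ⟩
    below p (u ++ ν) + at (suc p) (u ++ ν)         ≡⟨ sym (below-suc p (u ++ ν)) ⟩
    below (suc p) (u ++ ν)                         ∎
    where open ≤-Reasoning
lift-step {p} {ν} {ν′} K step u {P} (running r R)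
  with π′ , sub′ , balance ← step u (Running.sub R)
  = P , running r (record
      { q-once  = trans (moved (q (ix r) (suc p)) (q-eq r)) q-once
      ; c-once  = trans (moved (c (ix r) p) (c-eq r)) c-once
      ; layer   = layer′
      ; sub     = sub′
      ; counter = Counter-transfer r others counter-balance counter
      }) , cong (P +_) (trans (bsum-above ν′ empty-above′) (sym (bsum-above ν empty-above)))
  where
  open Confined K
  open Running R
  moved : ∀ v → expo v ν ≡ expo v ν′ → expo v (u ++ ν′) ≡ expo v (u ++ ν)
  moved v eq = trans (expo-++ v u ν′) (trans (cong (expo v u +_) (sym eq)) (sym (expo-++ v u ν)))
  others-ν : ∀ k → k ≢ r → bs p ν′ k ≡ bs p ν k
  others-ν k k≢r = sym (b-eq k (m+n≡0⇒n≡0 (expo (c (ix k) p) u) (trans (sym (expo-++ _ u ν))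
    (layer-excludes (u ++ ν) r (c (ix k) p) q-once c-once layer refl
      ((λ ()) ∷ (k≢r ∘ ix-injective ∘ c-injective) ∷ (λ ()) ∷ (λ ()) ∷ (λ ()) ∷ (λ ()) ∷ [])))))
  others : ∀ k → k ≢ r → bs p (u ++ ν′) k ≡ bs p (u ++ ν) k
  others k k≢r = moved (b (ix k) p) (sym (others-ν k k≢r))
  counter-balance : π + bs p (u ++ ν′) r ≡ π′ + bs p (u ++ ν) r
  counter-balance = subst₂ (λ m n → π + m ≡ π′ + n) (sym (expo-++ _ u ν′)) (sym (expo-++ _ u ν))
    (balance-transfer {π} {π′} {bsum p ν} {bsum p ν′} {bs p ν r} {bs p ν′ r} (bs p u r) balance (bsum-balance p r ν ν′ others-ν))
  layer′ : at (suc p) (u ++ ν′) ≡ 2 + bsum p (u ++ ν′)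
  layer′ = trans (count-++ _ u ν′) (trans
    (layer-transfer 2 {at (suc p) u} {at (suc p) ν} {at (suc p) ν′} {bsum p u} {bsum p ν} {bsum p ν′}
      (trans (sym (count-++ _ u ν)) (trans layer (cong (2 +_) (Σexpo-++ (bvars p) u ν)))) at-balance)
    (cong (2 +_) (sym (Σexpo-++ (bvars p) u ν′))))

terminal-swap : ∀ {m ν ν′} t t′ → expo (terminalVar t m) ν ≡ 1 → below m ν ≡ 1 → expo (terminalVar t′ m) ν′ ≡ 1 → below m ν′ ≡ 1 →
                terminalValue t m + bsum m ν′ ≡ terminalValue t′ m + bsum m ν → ConfigStep m ν ν′
terminal-swap {m} {ν} {ν′} t t′ t≡1 below-ν t′≡1 below-ν′ bal u C
  with P≡ , below-u ← terminal-view {m} {u} {ν} t t≡1 below-ν C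
  = _ , terminal-build {m} {u} {ν′} t′ t′≡1 below-ν′ below-u , subst (λ P → P + bsum m ν′ ≡ _) (sym P≡) bal

level0-step : ∀ {ν ν′} → (ν ∷ ν′ ∷ []) ∈ 𝒫₀ → ConfigStep 0 ν ν′ × ConfigStep 0 ν′ ν
level0-step (here refl) =
  terminal-swap finish start refl refl refl refl refl , terminal-swap start finish refl refl refl refl refl
level0-step (there (here refl)) =
  terminal-swap finish start refl refl refl refl refl , terminal-swap start finish refl refl refl refl refl
level0-step (there (there (here refl))) =
  terminal-swap finish start refl refl refl refl refl , terminal-swap start finish refl refl refl refl refl
level0-step (there (there (there (here refl)))) =
  terminal-swap finish start refl refl refl refl refl , terminal-swap start finish refl refl refl refl refl

Generator : ℕ → Mono → Mono → Set
Generator m ν ν′ = (ν ∷ ν′ ∷ []) ∈ 𝒫 m ⊎ (ν′ ∷ ν ∷ []) ∈ 𝒫 m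

private
  ConfinedBinomial : ℕ → Poly → Set
  ConfinedBinomial m (ν ∷ ν′ ∷ []) = Confined m ν ν′
  ConfinedBinomial m _             = ⊥

  confinedBinomial? : ∀ m g → Dec (ConfinedBinomial m g)
  confinedBinomial? m []                 = no λ ()
  confinedBinomial? m (_ ∷ [])           = no λ ()
  confinedBinomial? m (ν ∷ ν′ ∷ [])      = confined? m ν ν′
  confinedBinomial? m (_ ∷ _ ∷ _ ∷ _)    = no λ ()

  level0-confined : All (ConfinedBinomial 0) 𝒫₀
  level0-confined = toWitness {a? = All.all? (confinedBinomial? 0) 𝒫₀} _

  level1-confined : All (ConfinedBinomial 1) (𝒫suc 0)
  level1-confined = toWitness {a? = All.all? (confinedBinomial? 1) (𝒫suc 0)} _

  OwnGenerator : ℕ → Mono → Mono → Set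
  OwnGenerator p ν ν′ = ∃₂ λ x₀ y₀ → ((x₀ ∷ y₀ ∷ []) ∈ 𝒫suc 0 ⊎ (y₀ ∷ x₀ ∷ []) ∈ 𝒫suc 0) ×
                                     ν ≡ map (shift p) x₀ × ν′ ≡ map (shift p) y₀

  𝒫suc-shift : ∀ p {ν ν′} → (ν ∷ ν′ ∷ []) ∈ 𝒫suc p →
               ∃₂ λ x₀ y₀ → (x₀ ∷ y₀ ∷ []) ∈ 𝒫suc 0 × ν ≡ map (shift p) x₀ × ν′ ≡ map (shift p) y₀
  𝒫suc-shift p h with ∈-map⁻ (map (map (shift p))) {xs = 𝒫suc 0} h
  ... | x₀ ∷ y₀ ∷ [] , g₀ , refl = x₀ , y₀ , g₀ , refl , refl

  own-or-lower : ∀ p {ν ν′} → Generator (suc p) ν ν′ → OwnGenerator p ν ν′ ⊎ Generator p ν ν′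
  own-or-lower p (inj₁ h) with ∈-++⁻ (𝒫suc p) h
  ... | inj₁ own with x₀ , y₀ , g₀ , refl , refl ← 𝒫suc-shift p own = inj₁ (x₀ , y₀ , inj₁ g₀ , refl , refl)
  ... | inj₂ low = inj₂ (inj₁ low)
  own-or-lower p (inj₂ h) with ∈-++⁻ (𝒫suc p) h
  ... | inj₁ own with y₀ , x₀ , g₀ , refl , refl ← 𝒫suc-shift p own = inj₁ (x₀ , y₀ , inj₂ g₀ , refl , refl)
  ... | inj₂ low = inj₂ (inj₂ low)

generator-confined : ∀ m {ν ν′} → Generator m ν ν′ → Confined m ν ν′
generator-confined zero (inj₁ h) = All.lookup level0-confined h
generator-confined zero (inj₂ h) = Confined-swap (All.lookup level0-confined h)
generator-confined (suc p) g with own-or-lower p g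
... | inj₁ (_ , _ , inj₁ g₀ , refl , refl) = Confined-shift p (All.lookup level1-confined g₀)
... | inj₁ (_ , _ , inj₂ g₀ , refl , refl) = Confined-shift p (Confined-swap (All.lookup level1-confined g₀))
... | inj₂ low                             = Confined-lift (generator-confined p low)

generator-step : ∀ m {ν ν′} → Generator m ν ν′ → ConfigStep m ν ν′
generator-step zero (inj₁ h) = proj₁ (level0-step h)
generator-step zero (inj₂ h) = proj₂ (level0-step h)
generator-step (suc p) g with own-or-lower p g
... | inj₁ (_ , _ , inj₁ g₀ , refl , refl) = proj₁ (own-step p g₀)
... | inj₁ (_ , _ , inj₂ g₀ , refl , refl) = proj₂ (own-step p g₀)
... | inj₂ low                             = lift-step (generator-confined p low) (generator-step p low)

-- c_{rn} b_{rn}^P times a level-n configuration of progress P, and nothing else of level ≥ n+1.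
record TopConfig (n : ℕ) (r : Phase) (μ : Mono) : Set where
  field
    c-once      : expo (c (ix r) n) μ ≡ 1
    top-layer   : at (suc n) μ ≡ 1 + bs n μ r
    none-above  : above (2 + n) μ ≡ 0
    config      : Config n μ (bs n μ r)

TopConfig? : ∀ n r μ → Dec (TopConfig n r μ)
TopConfig? n r μ with expo (c (ix r) n) μ ≟ 1 ×-dec at (suc n) μ ≟ 1 + bs n μ r ×-dec above (2 + n) μ ≟ 0 | Config? n μ
... | no ¬h | _     = no λ T → let open TopConfig T in ¬h (c-once , top-layer , none-above)
... | yes _ | no ¬C = no λ T → ¬C (_ , TopConfig.config T)
... | yes (h₁ , h₂ , h₃) | yes (P , C) with P ≟ bs n μ r
...   | yes refl = yes (record { c-once = h₁ ; top-layer = h₂ ; none-above = h₃ ; config = C })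
...   | no P≢    = no λ T → P≢ (Config-functional C (TopConfig.config T))

TopConfig-resp : ∀ {n r μ ν} → μ ≈M ν → TopConfig n r μ → TopConfig n r ν
TopConfig-resp {n} {r} {μ} {ν} eq T = record
  { c-once      = trans (sym (eq _)) c-once
  ; top-layer   = trans (sym (at-resp (suc n) {μ} {ν} eq)) (trans top-layer (cong suc (eq _)))
  ; none-above  = trans (sym (above-resp (2 + n) {μ} {ν} eq)) none-above
  ; config      = subst (Config n ν) (eq _) (Config-resp eq config)
  }
  where open TopConfig T

TopConfig-step : ∀ {n r ν ν′} → Generator n ν ν′ → ∀ u → TopConfig n r (u ++ ν) → TopConfig n r (u ++ ν′)
TopConfig-step {n} {r} {ν} {ν′} g u T
  with P′ , C′ , balance ← generator-step n g u (TopConfig.config T)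
  = record
  { c-once      = trans (moved (c (ix r) n) (c-eq r)) c-once
  ; top-layer   = trans (count-++ _ u ν′) (trans
      (layer-transfer 1 {at (suc n) u} {at (suc n) ν} {at (suc n) ν′} {bs n u r} {bs n ν r} {bs n ν′ r}
        (trans (sym (count-++ _ u ν)) (trans top-layer (cong suc (expo-++ _ u ν))))
        (balance-transfer {at (suc n) ν} {at (suc n) ν′} {bsum n ν} {bsum n ν′} 0 at-balance b-balance))
      (cong suc (sym (expo-++ _ u ν′))))
  ; none-above  = trans (count-++ _ u ν′) (cong₂ _+_ (m+n≡0⇒m≡0 _ above-split) empty-above′)
  ; config      = subst (Config n (u ++ ν′)) (sym b-count) C′
  }
  where
  open TopConfig T
  open Confined (generator-confined n g)
  moved : ∀ v → expo v ν ≡ expo v ν′ → expo v (u ++ ν′) ≡ expo v (u ++ ν)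
  moved v eq = trans (expo-++ v u ν′) (trans (cong (expo v u +_) (sym eq)) (sym (expo-++ v u ν)))
  above-split : above (2 + n) u + above (2 + n) ν ≡ 0
  above-split = trans (sym (count-++ _ u ν)) none-above
  others-ν : ∀ k → k ≢ r → bs n ν′ k ≡ bs n ν k
  others-ν k k≢r = sym (b-eq k (m+n≡0⇒n≡0 (expo (c (ix k) n) u) (trans (sym (expo-++ _ u ν))
    (at-excluded {suc n} {u ++ ν} (c (ix k) n) (c (ix r) n ∷ b (ix r) n ∷ [])
      (((k≢r ∘ ix-injective ∘ c-injective) ∷ (λ ()) ∷ []) ∷ ((λ ()) ∷ []) ∷ [] ∷ []) (refl ∷ refl ∷ refl ∷ [])
      (trans top-layer (sym (cong₂ _+_ c-once (+-identityʳ (bs n (u ++ ν) r)))))))))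
  b-balance : bsum n ν + bs n ν′ r ≡ bsum n ν′ + bs n ν r
  b-balance = bsum-balance n r ν ν′ others-ν
  b-count : bs n (u ++ ν′) r ≡ P′
  b-count = +-cancelʳ-≡ (bsum n ν) _ _ (begin
    bs n (u ++ ν′) r + bsum n ν                 ≡⟨ cong (_+ bsum n ν) (expo-++ _ u ν′) ⟩
    bs n u r + bs n ν′ r + bsum n ν             ≡⟨ +-assoc (bs n u r) _ _ ⟩
    bs n u r + (bs n ν′ r + bsum n ν)           ≡⟨ cong (bs n u r +_) (trans (+-comm _ (bsum n ν)) b-balance) ⟩
    bs n u r + (bsum n ν′ + bs n ν r)           ≡⟨ cong (bs n u r +_) (+-comm (bsum n ν′) _) ⟩
    bs n u r + (bs n ν r + bsum n ν′)           ≡⟨ sym (+-assoc (bs n u r) _ _) ⟩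
    bs n u r + bs n ν r + bsum n ν′             ≡⟨ cong (_+ bsum n ν′) (sym (expo-++ _ u ν)) ⟩
    bs n (u ++ ν) r + bsum n ν′                 ≡⟨ balance ⟩
    P′ + bsum n ν                               ∎)
    where open ≡-Reasoning

TopConfig-start : ∀ n r → TopConfig n r (c (ix r) n ∷ s n ∷ [])
TopConfig-start n r = record
  { c-once      = trans (expo-here (c (ix r) n) (s n ∷ [])) (cong suc (expo-there {c (ix r) n} {s n} [] (λ ())))
  ; top-layer   = trans (count-here {t = λ w → level w ≡ᵇ suc n} (c (ix r) n) (s n ∷ []) (≡⇒≡ᵇ≡true {suc n} refl))
                        (cong suc (trans (count-there {t = λ w → level w ≡ᵇ suc n} (s n) [] (dec-false (n ≟ suc n) (1+n≢n ∘ sym)))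
                                         (sym b-free)))
  ; none-above  = trans (count-there {t = λ w → 2 + n ≤ᵇ level w} (c (ix r) n) (s n ∷ []) (dec-false (2 + n ≤? suc n) 1+n≰n))
                        (count-there {t = λ w → 2 + n ≤ᵇ level w} (s n) [] (dec-false (2 + n ≤? n) (1+n≰n ∘ ≤-trans (n≤1+n _))))
  ; config      = subst (Config n (c (ix r) n ∷ s n ∷ [])) (sym b-free)
                    (terminal start (trans (expo-there {s n} {c (ix r) n} (s n ∷ []) (λ ())) (expo-here (s n) []))
                      (trans (count-there {t = λ w → level w ≤ᵇ n} (c (ix r) n) (s n ∷ []) (dec-false (suc n ≤? n) 1+n≰n))
                             (count-here {t = λ w → level w ≤ᵇ n} (s n) [] (≤⇒≤ᵇ≡true {n} ≤-refl))))
  }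
  where
  b-free : bs n (c (ix r) n ∷ s n ∷ []) r ≡ 0
  b-free = trans (expo-there {b (ix r) n} {c (ix r) n} (s n ∷ []) (λ ())) (expo-there {b (ix r) n} {s n} [] (λ ()))

TopConfig-finished : ∀ {n r α} → TopConfig n r α → 1 ≤ expo (f n) α →
                     α ≈M (replicate (e n) (b (ix r) n) ++ c (ix r) n ∷ f n ∷ [])
TopConfig-finished {n} {r} {α} T f≥1 v = trans (exponent v) (sym (expo-++ v (replicate (e n) (b (ix r) n)) _))
  where
  open TopConfig T
  finished = terminal-inv finish config f≥1
  f≡1 : expo (f n) α ≡ 1
  f≡1 = ≤-antisym (subst (expo (f n) α ≤_) (proj₂ finished) (expo≤count {t = λ w → level w ≤ᵇ n} (f n) α (≤⇒≤ᵇ≡true {n} ≤-refl))) f≥1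
  layer-vars : at (suc n) α ≡ Σexpo (c (ix r) n ∷ b (ix r) n ∷ []) α
  layer-vars = trans top-layer (sym (cong₂ _+_ c-once (+-identityʳ (bs n α r))))
  absent : ∀ v → v ≢ f n → v ≢ c (ix r) n → v ≢ b (ix r) n → expo v α ≡ 0
  absent v v≢f v≢c v≢b with level v ≤? n | level v ≟ suc n
  ... | yes lv≤n | _        = terminal-excludes α finish v f≡1 (proj₂ finished) lv≤n v≢f
  ... | no _     | yes lv≡  = at-excluded {suc n} {α} v (c (ix r) n ∷ b (ix r) n ∷ [])
                                ((v≢c ∷ v≢b ∷ []) ∷ ((λ ()) ∷ []) ∷ [] ∷ []) (lv≡ ∷ refl ∷ refl ∷ []) layer-vars
  ... | no lv≰n  | no lv≢   = above-zero⇒expo-zero α v none-above (≤∧≢⇒< (≰⇒> lv≰n) (lv≢ ∘ sym))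
  exponent : ∀ v → expo v α ≡ expo v (replicate (e n) (b (ix r) n)) + expo v (c (ix r) n ∷ f n ∷ [])
  exponent v with v ≟V f n
  ... | yes refl = trans f≡1 (sym (cong (_+ 1) (expo-replicate-≢ (e n) (λ ()))))
  ... | no v≢f with v ≟V c (ix r) n
  ...   | yes refl = trans c-once (sym (cong (_+ 1) (expo-replicate-≢ (e n) (λ ()))))
  ...   | no v≢c with v ≟V b (ix r) n
  ...     | yes refl = trans (proj₁ finished) (sym (trans (cong (_+ 0) (expo-replicate (b (ix r) n) (e n))) (+-identityʳ (e n))))
  ...     | no v≢b   = trans (absent v v≢f v≢c v≢b) (sym (cong (_+ 0) (expo-replicate-≢ (e n) v≢b)))

private
  IsBinomial : Poly → Set
  IsBinomial g = ∃₂ λ ν ν′ → g ≡ ν ∷ ν′ ∷ []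

  binomial? : ∀ g → Dec (IsBinomial g)
  binomial? []               = no λ ()
  binomial? (_ ∷ [])         = no λ ()
  binomial? (ν ∷ ν′ ∷ [])    = yes (ν , ν′ , refl)
  binomial? (_ ∷ _ ∷ _ ∷ _)  = no λ ()

  𝒫-binomial : ∀ n → All IsBinomial (𝒫 n)
  𝒫-binomial zero    = toWitness {a? = All.all? binomial? 𝒫₀} _
  𝒫-binomial (suc p) = ++⁺ (map⁺ (All.map shifted (toWitness {a? = All.all? binomial? (𝒫suc 0)} _))) (𝒫-binomial p)
    where
    shifted : ∀ {g} → IsBinomial g → IsBinomial (map (map (shift p)) g)
    shifted (ν , ν′ , refl) = map (shift p) ν , map (shift p) ν′ , refl

TopConfig-reached : ∀ n r {α} → (mono (c (ix r) n ∷ s n ∷ []) +P mono α) ∈⟨ 𝒫 n ⟩ → TopConfig n r α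
TopConfig-reached n r {α} member = decided (TopConfig? n r α) (trans (sym (dec-true (TopConfig? n r _) (TopConfig-start n r)))
  (binomial-ideal-invariant reachable (λ {μ} {ν} → same-class {μ} {ν}) {𝒫 n} {c (ix r) n ∷ s n ∷ []} {α} moves member))
  where
  reachable : Mono → Bool
  reachable μ = does (TopConfig? n r μ)
  same-class : ∀ {μ ν} → μ ≈M ν → reachable μ ≡ reachable ν
  same-class {μ} {ν} eq = does-⇔ (mk⇔ (TopConfig-resp {n} {r} {μ} {ν} eq) (TopConfig-resp {n} {r} {ν} {μ} (λ v → sym (eq v))))
                                 (TopConfig? n r μ) (TopConfig? n r ν)
  moves : ∀ {g} → g ∈ 𝒫 n → BinomialInvariant reachable g
  moves g∈ with ν , ν′ , refl ← All.lookup (𝒫-binomial n) g∈ =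
    ν , ν′ , refl , λ u → does-⇔ (mk⇔ (TopConfig-step {n} {r} (inj₁ g∈) u) (TopConfig-step {n} {r} (inj₂ g∈) u))
                                 (TopConfig? n r (u ++ ν)) (TopConfig? n r (u ++ ν′))
  decided : (T? : Dec (TopConfig n r α)) → true ≡ does T? → TopConfig n r α
  decided (yes T) _ = T

phase-of : ∀ {j} → 1 ≤ j → j ≤ 4 → ∃ λ r → ix r ≡ j
phase-of {1} _ _ = ϕ₁ , refl
phase-of {2} _ _ = ϕ₂ , refl
phase-of {3} _ _ = ϕ₃ , refl
phase-of {4} _ _ = ϕ₄ , refl
phase-of {suc (suc (suc (suc (suc _))))} _ (s≤s (s≤s (s≤s (s≤s ()))))

lemma5p3 : (n j : ℕ) → 1 ≤ j → j ≤ 4 → (α : Mono) →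
           (mono (c j n ∷ s n ∷ []) +P mono α) ∈⟨ 𝒫 n ⟩ →
           mono (f n ∷ []) ∣P mono α →
           mono α ≈P mono (replicate (e n) (b j n) ++ (c j n ∷ f n ∷ []))
lemma5p3 n j 1≤j j≤4 α member f∣α with r , refl ← phase-of 1≤j j≤4 =
  mono-≈P (TopConfig-finished (TopConfig-reached n r member) (∣P⇒expo f∣α))
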